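{- Let $k$ be a positive integer. Then, as formal power series in $q$ (equivalently, for complex $|q|<1$), $$(-q;q)_\infty \sum_{n=0}^{2k-1} (-1)^{T_n} q^{2G_n} = \frac{(q^2;q^2)_\infty}{(q;q^2)_\infty}+(-1)^{k-1} \frac{(q^2;q^2)_\infty}{(q;q^2)_\infty} \sum_{n=1}^{\infty} \frac{q^{k(k-1)+2(k+1)n}}{(q^2;q^2)_n} \begin{bmatrix} n-1\\k-1 \end{bmatrix}_{q^2}.$$
   Context: For a nonnegative integer $n$, $T_n=n(n+1)/2$ is the $n$th triangular number and $G_n=T_n-T_{\lfloor n/2\rfloor}$ is the $n$th generalized pentagonal number. The $q$-Pochhammer symbol is $(a;q)_0=1$, $(a;q)_n=(1-a)(1-aq)\cdots(1-aq^{n-1})$ for $n>0$, and $(a;q)_\infty=\lim_{n\to\infty}(a;q)_n$. The Gaussian binomial coefficient $\begin{bmatrix} n\\k\end{bmatrix}_{q}$ equals $0$ if $k<0$ or $k>n$, and $\frac{(q;q)_n}{(q;q)_k(q;q)_{n-k}}$ otherwise; the subscript $q^2$ means $q$ is replaced by $q^2$. -}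

module Defs where

open import Data.Nat using (ℕ; zero; suc; _∸_; _≤?_; _≟_)
import Data.Nat as ℕ
open import Data.Nat.DivMod using (_/_; _%_)
open import Data.Integer using (ℤ; +_; -_; _+_; _*_)
open import Data.List using (List; []; _∷_)
open import Relation.Nullary using (yes; no)

-- Formal power series over ℤ, represented by their coefficient sequences:
-- f n is the coefficient of q^n.
FPS : Set
FPS = ℕ → ℤ

sumTo : ℕ → (ℕ → ℤ) → ℤ
sumTo zero    f = f 0
sumTo (suc n) f = sumTo n f + f (suc n)

zeroS : FPS
zeroS _ = + 0

mono : ℤ → ℕ → FPS
mono c e n with n ≟ e
... | yes _ = c
... | no  _ = + 0

oneS : FPS
oneS = mono (+ 1) 0

infixl 6 _⊕_
infixl 7 _⊛_

_⊕_ : FPS → FPS → FPS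
(f ⊕ g) n = f n + g n

scale : ℤ → FPS → FPS
scale c f n = c * f n

_⊛_ : FPS → FPS → FPS
(f ⊛ g) n = sumTo n (λ i → f i * g (n ∸ i))

finProd : (ℕ → FPS) → ℕ → FPS
finProd F zero    = oneS
finProd F (suc m) = finProd F m ⊛ F m

-- Multiplicative inverse of a series with constant term 1:
-- g 0 = 1, g n = - Σ_{i=1}^{n} f i * g (n-i).
lookupD : List ℤ → ℕ → ℤ
lookupD []       _       = + 0
lookupD (x ∷ xs) zero    = x
lookupD (x ∷ xs) (suc i) = lookupD xs i

-- invList f n = [g n , g (n-1) , ... , g 0]
invList : FPS → ℕ → List ℤ
invList f zero    = + 1 ∷ []
invList f (suc n) =
  (- sumTo n (λ i → f (suc i) * lookupD (invList f n) i)) ∷ invList f n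

inv : FPS → FPS
inv f n = lookupD (invList f n) 0

-- q-Pochhammer symbol (s q^c ; q^d)_n = Π_{j<n} (1 - s q^(c + d j)), s ∈ ℤ
pochFactor : ℤ → ℕ → ℕ → ℕ → FPS
pochFactor s c d j = oneS ⊕ mono (- s) (c ℕ.+ d ℕ.* j)

poch : ℤ → ℕ → ℕ → ℕ → FPS
poch s c d n = finProd (pochFactor s c d) n

-- (s q^c ; q^d)_∞ for c ≥ 1, d ≥ 1: the j-th factor is 1 + O(q^(j+1)),
-- so the coefficient of q^N is that of the finite product of the first N+1 factors.
pochInf : ℤ → ℕ → ℕ → FPS
pochInf s c d N = poch s c d (suc N) N

gauss : ℕ → ℕ → FPS
gauss n k with k ≤? n
... | yes _ = poch (+ 1) 1 1 n ⊛ inv (poch (+ 1) 1 1 k) ⊛ inv (poch (+ 1) 1 1 (n ∸ k))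
... | no  _ = zeroS

dil2 : FPS → FPS
dil2 f n with n % 2
... | zero  = f (n / 2)
... | suc _ = + 0

-- Σ_{n≥1} t n, used only for families whose n-th term has q-adic order > n
-- (here order ≥ 2(k+1)n), so the coefficient of q^N only receives
-- contributions from n = 1 .. N (we sum n = 1 .. N+1, the extra term is 0).
infSum1 : (ℕ → FPS) → FPS
infSum1 t N = sumTo N (λ j → t (suc j) N)

negOnePow : ℕ → ℤ
negOnePow zero    = + 1
negOnePow (suc m) = - negOnePow m

T : ℕ → ℕ
T n = (n ℕ.* suc n) / 2

G : ℕ → ℕ
G n = T n ∸ T (n / 2)

lhs : ℕ → FPS
lhs k = pochInf (- + 1) 1 1 ⊛ (λ N → sumTo (2 ℕ.* k ∸ 1) (λ n → mono (negOnePow (T n)) (2 ℕ.* G n) N))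

A : FPS
A = pochInf (+ 1) 2 2 ⊛ inv (pochInf (+ 1) 1 2)

term : ℕ → ℕ → FPS
term k n = mono (+ 1) (k ℕ.* (k ∸ 1) ℕ.+ 2 ℕ.* suc k ℕ.* n)
           ⊛ inv (poch (+ 1) 2 2 n)
           ⊛ dil2 (gauss (n ∸ 1) (k ∸ 1))

rhs : ℕ → FPS
rhs k = A ⊕ scale (negOnePow (k ∸ 1)) (A ⊛ infSum1 (term k))

-- Write x = q², S_k for the series on the right and L_k for the finite sum on the left. Euler's
-- identity (-q;q)_∞ (q;q²)_∞ = 1 turns the claim into L_k = (q²;q²)_∞ (1 + (-1)^(k-1) S_k). As
-- L_(k+1) - L_k = (-1)^k (q^(2G_(2k)) - q^(2G_(2k+1))), induction on k reduces it to
-- (q²;q²)_∞ (1 + S_1) = 1 - q² and (q²;q²)_∞ (S_k + S_(k+1)) = q^(2G_(2k)) - q^(2G_(2k+1)).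
-- For the latter, a rational identity shows that the summand of S_k with n = k + m + 1 plus the
-- summand of S_(k+1) with n = k + 1 + m equals q^(2G_(2k)) t_(m+1) - q^(2G_(2k+1)) t_m, where
-- t_m = x^((k+1)m) / ((x;x)_k (x;x)_m); Euler's sum Σ_m x^((k+1)m) / (x;x)_m = (x;x)_k / (x;x)_∞
-- then finishes the argument. Every identity is proved coefficientwise up to q^N, where all
-- infinite products and sums are finite.

module Submission where

open import Defs
open import Data.Nat using (ℕ; _≤_)
open import Relation.Binary.PropositionalEquality using (_≡_)

open import Data.Nat as N using (zero; suc; _+_; _*_; _∸_; z≤n; s≤s; _<_)
import Data.Nat.Properties as NP
import Data.Nat.DivMod as DM
import Data.Nat.Divisibility as ND
open import Data.Integer as Z using (ℤ; +_; -_) renaming (_+_ to _+ℤ_; _*_ to _*ℤ_)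
import Data.Integer.Properties as ZP
open import Data.Integer.Solver using (module +-*-Solver)
open import Data.Nat.Solver using () renaming (module +-*-Solver to ℕ-Solver)
open import Relation.Binary.PropositionalEquality using (refl; sym; trans; cong; cong₂; module ≡-Reasoning)
open import Relation.Nullary using (Dec; yes; no; ¬_)
open import Data.Empty using (⊥-elim)
open import Function using (_∘_)

sumTo-cong : ∀ n {f g : ℕ → ℤ} → (∀ i → i ≤ n → f i ≡ g i) → sumTo n f ≡ sumTo n g
sumTo-cong zero    f≡g = f≡g 0 z≤n
sumTo-cong (suc n) f≡g =
  cong₂ _+ℤ_ (sumTo-cong n (λ i i≤n → f≡g i (NP.m≤n⇒m≤1+n i≤n))) (f≡g (suc n) NP.≤-refl)

sumTo-distrib-+ : ∀ n (f g : ℕ → ℤ) → sumTo n (λ i → f i +ℤ g i) ≡ sumTo n f +ℤ sumTo n g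
sumTo-distrib-+ zero    f g = refl
sumTo-distrib-+ (suc n) f g =
  trans (cong (_+ℤ (f (suc n) +ℤ g (suc n))) (sumTo-distrib-+ n f g))
        (interchange (sumTo n f) (sumTo n g) _ _)
  where
  open +-*-Solver
  interchange : ∀ a b c d → (a +ℤ b) +ℤ (c +ℤ d) ≡ (a +ℤ c) +ℤ (b +ℤ d)
  interchange = solve 4 (λ a b c d → (a :+ b) :+ (c :+ d) := (a :+ c) :+ (b :+ d)) refl

*-distribˡ-sumTo : ∀ n c (f : ℕ → ℤ) → c *ℤ sumTo n f ≡ sumTo n (λ i → c *ℤ f i)
*-distribˡ-sumTo zero    c f = refl
*-distribˡ-sumTo (suc n) c f =
  trans (ZP.*-distribˡ-+ c (sumTo n f) (f (suc n))) (cong (_+ℤ c *ℤ f (suc n)) (*-distribˡ-sumTo n c f))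

sumTo-suc-head : ∀ n (f : ℕ → ℤ) → sumTo (suc n) f ≡ f 0 +ℤ sumTo n (f ∘ suc)
sumTo-suc-head zero    f = refl
sumTo-suc-head (suc n) f = trans (cong (_+ℤ f (suc (suc n))) (sumTo-suc-head n f)) (ZP.+-assoc (f 0) _ _)

sumTo-zeros : ∀ n (f : ℕ → ℤ) → (∀ i → i ≤ n → f i ≡ + 0) → sumTo n f ≡ + 0
sumTo-zeros n f f≡0 = trans (sumTo-cong n f≡0) (sumTo-const0 n)
  where
  sumTo-const0 : ∀ n → sumTo n (λ _ → + 0) ≡ + 0
  sumTo-const0 zero    = refl
  sumTo-const0 (suc n) = cong (_+ℤ + 0) (sumTo-const0 n)

sumTo-reverse : ∀ n (f : ℕ → ℤ) → sumTo n f ≡ sumTo n (λ i → f (n ∸ i))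
sumTo-reverse zero    f = refl
sumTo-reverse (suc n) f = begin
  sumTo (suc n) f
    ≡⟨ sumTo-suc-head n f ⟩
  f 0 +ℤ sumTo n (f ∘ suc)
    ≡⟨ cong (f 0 +ℤ_) (sumTo-reverse n (f ∘ suc)) ⟩
  f 0 +ℤ sumTo n (λ i → f (suc (n ∸ i)))
    ≡⟨ cong (f 0 +ℤ_) (sumTo-cong n (λ i i≤n → cong f (sym (NP.+-∸-assoc 1 i≤n)))) ⟩
  f 0 +ℤ sumTo n (λ i → f (suc n ∸ i))
    ≡⟨ ZP.+-comm (f 0) _ ⟩
  sumTo n (λ i → f (suc n ∸ i)) +ℤ f 0
    ≡⟨ cong (λ j → sumTo n (λ i → f (suc n ∸ i)) +ℤ f j) (sym (NP.n∸n≡0 n)) ⟩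
  sumTo (suc n) (λ i → f (suc n ∸ i)) ∎
  where open ≡-Reasoning

sumTo-pad : ∀ n k (f : ℕ → ℤ) → (∀ j → n < j → f j ≡ + 0) → sumTo (k + n) f ≡ sumTo n f
sumTo-pad n zero    f f≡0 = refl
sumTo-pad n (suc k) f f≡0 =
  trans (cong₂ _+ℤ_ (sumTo-pad n k f f≡0) (f≡0 (suc (k + n)) (s≤s (NP.m≤n+m n k))))
        (ZP.+-identityʳ _)

-- Coefficientwise algebra of series

infix 4 _≋_
_≋_ : FPS → FPS → Set
f ≋ g = ∀ n → f n ≡ g n

shift : FPS → FPS
shift f n = f (suc n)

negS : FPS → FPS
negS f n = - f n

⊛-suc : ∀ f g n → (f ⊛ g) (suc n) ≡ f 0 *ℤ g (suc n) +ℤ (shift f ⊛ g) n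
⊛-suc f g n = sumTo-suc-head n (λ i → f i *ℤ g (suc n ∸ i))

⊛-congʳ≋ : ∀ {f f′} g → f ≋ f′ → f ⊛ g ≋ f′ ⊛ g
⊛-congʳ≋ g f≋f′ n = sumTo-cong n (λ i _ → cong (_*ℤ g (n ∸ i)) (f≋f′ i))

⊛-congˡ≋ : ∀ f {g g′} → g ≋ g′ → f ⊛ g ≋ f ⊛ g′
⊛-congˡ≋ f g≋g′ n = sumTo-cong n (λ i _ → cong (f i *ℤ_) (g≋g′ (n ∸ i)))

⊛-distribʳ-⊕ : ∀ f g h → (f ⊕ g) ⊛ h ≋ f ⊛ h ⊕ g ⊛ h
⊛-distribʳ-⊕ f g h n =
  trans (sumTo-cong n (λ i _ → ZP.*-distribʳ-+ (h (n ∸ i)) (f i) (g i))) (sumTo-distrib-+ n _ _)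

⊛-distribˡ-⊕ : ∀ f g h → f ⊛ (g ⊕ h) ≋ f ⊛ g ⊕ f ⊛ h
⊛-distribˡ-⊕ f g h n =
  trans (sumTo-cong n (λ i _ → ZP.*-distribˡ-+ (f i) (g (n ∸ i)) (h (n ∸ i)))) (sumTo-distrib-+ n _ _)

scale-⊛ : ∀ c f g → scale c f ⊛ g ≋ scale c (f ⊛ g)
scale-⊛ c f g n =
  trans (sumTo-cong n (λ i _ → ZP.*-assoc c (f i) (g (n ∸ i)))) (sym (*-distribˡ-sumTo n c _))

⊛-comm : ∀ f g → f ⊛ g ≋ g ⊛ f
⊛-comm f g n = trans (sumTo-reverse n _) (sumTo-cong n (λ i i≤n →
  trans (cong (λ j → f (n ∸ i) *ℤ g j) (NP.m∸[m∸n]≡n i≤n)) (ZP.*-comm (f (n ∸ i)) (g i))))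

⊛-assoc : ∀ f g h → (f ⊛ g) ⊛ h ≋ f ⊛ (g ⊛ h)
⊛-assoc f g h zero    = ZP.*-assoc (f 0) (g 0) (h 0)
⊛-assoc f g h (suc n) = begin
  ((f ⊛ g) ⊛ h) (suc n)
    ≡⟨ ⊛-suc (f ⊛ g) h n ⟩
  (f 0 *ℤ g 0) *ℤ h (suc n) +ℤ (shift (f ⊛ g) ⊛ h) n
    ≡⟨ cong (f 0 *ℤ g 0 *ℤ h (suc n) +ℤ_) (⊛-congʳ≋ h (⊛-suc f g) n) ⟩
  (f 0 *ℤ g 0) *ℤ h (suc n) +ℤ ((scale (f 0) (shift g) ⊕ shift f ⊛ g) ⊛ h) n
    ≡⟨ cong (f 0 *ℤ g 0 *ℤ h (suc n) +ℤ_) (⊛-distribʳ-⊕ (scale (f 0) (shift g)) (shift f ⊛ g) h n) ⟩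
  (f 0 *ℤ g 0) *ℤ h (suc n) +ℤ ((scale (f 0) (shift g) ⊛ h) n +ℤ ((shift f ⊛ g) ⊛ h) n)
    ≡⟨ cong (f 0 *ℤ g 0 *ℤ h (suc n) +ℤ_) (cong₂ _+ℤ_ (scale-⊛ (f 0) (shift g) h n) (⊛-assoc (shift f) g h n)) ⟩
  (f 0 *ℤ g 0) *ℤ h (suc n) +ℤ (f 0 *ℤ (shift g ⊛ h) n +ℤ (shift f ⊛ (g ⊛ h)) n)
    ≡⟨ regroup (f 0) (g 0) (h (suc n)) ((shift g ⊛ h) n) ((shift f ⊛ (g ⊛ h)) n) ⟩
  f 0 *ℤ (g 0 *ℤ h (suc n) +ℤ (shift g ⊛ h) n) +ℤ (shift f ⊛ (g ⊛ h)) n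
    ≡⟨ cong (λ z → f 0 *ℤ z +ℤ (shift f ⊛ (g ⊛ h)) n) (sym (⊛-suc g h n)) ⟩
  f 0 *ℤ (g ⊛ h) (suc n) +ℤ (shift f ⊛ (g ⊛ h)) n
    ≡⟨ sym (⊛-suc f (g ⊛ h) n) ⟩
  (f ⊛ (g ⊛ h)) (suc n) ∎
  where
  open ≡-Reasoning
  open +-*-Solver
  regroup : ∀ a b c d e → (a *ℤ b) *ℤ c +ℤ (a *ℤ d +ℤ e) ≡ a *ℤ (b *ℤ c +ℤ d) +ℤ e
  regroup = solve 5 (λ a b c d e → (a :* b) :* c :+ (a :* d :+ e) := a :* (b :* c :+ d) :+ e) refl

⊛-zeroˡ : ∀ g → zeroS ⊛ g ≋ zeroS
⊛-zeroˡ g n = sumTo-zeros n _ (λ i _ → refl)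

scale-as-⊛ : ∀ c g → mono c 0 ⊛ g ≋ scale c g
scale-as-⊛ c g zero    = refl
scale-as-⊛ c g (suc n) =
  trans (⊛-suc (mono c 0) g n)
        (trans (cong (c *ℤ g (suc n) +ℤ_) (trans (⊛-congʳ≋ {shift (mono c 0)} g (λ _ → refl) n) (⊛-zeroˡ g n)))
               (ZP.+-identityʳ _))

⊛-identityˡ : ∀ f → oneS ⊛ f ≋ f
⊛-identityˡ f n = trans (scale-as-⊛ (+ 1) f n) (ZP.*-identityˡ (f n))

⊛-identityʳ : ∀ f → f ⊛ oneS ≋ f
⊛-identityʳ f n = trans (⊛-comm f oneS n) (⊛-identityˡ f n)

delay : FPS → FPS
delay f zero    = + 0
delay f (suc n) = f n

delay-cong : ∀ {f g} → f ≋ g → delay f ≋ delay g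
delay-cong f≋g zero    = refl
delay-cong f≋g (suc n) = f≋g n

delay-⊛ : ∀ f g n → (delay f ⊛ g) (suc n) ≡ (f ⊛ g) n
delay-⊛ f g n = trans (⊛-suc (delay f) g n) (ZP.+-identityˡ _)

mono-≡ : ∀ c e → mono c e e ≡ c
mono-≡ c e with e N.≟ e
... | yes _  = refl
... | no e≢e = ⊥-elim (e≢e refl)

mono-≢ : ∀ c e n → ¬ n ≡ e → mono c e n ≡ + 0
mono-≢ c e n n≢e with n N.≟ e
... | yes n≡e = ⊥-elim (n≢e n≡e)
... | no _    = refl

mono-suc : ∀ c e n → mono c (suc e) (suc n) ≡ mono c e n
mono-suc c e n = by-cases (n N.≟ e)
  where
  by-cases : Dec (n ≡ e) → mono c (suc e) (suc n) ≡ mono c e n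
  by-cases (yes refl) = trans (mono-≡ c (suc n)) (sym (mono-≡ c n))
  by-cases (no n≢e)   = trans (mono-≢ c (suc e) (suc n) (n≢e ∘ NP.suc-injective)) (sym (mono-≢ c e n n≢e))

scale-mono : ∀ a c e → scale a (mono c e) ≋ mono (a *ℤ c) e
scale-mono a c e n = by-cases (n N.≟ e)
  where
  by-cases : Dec (n ≡ e) → a *ℤ mono c e n ≡ mono (a *ℤ c) e n
  by-cases (yes refl) = trans (cong (a *ℤ_) (mono-≡ c n)) (sym (mono-≡ (a *ℤ c) n))
  by-cases (no n≢e)   = trans (cong (a *ℤ_) (mono-≢ c e n n≢e)) (trans (ZP.*-zeroʳ a) (sym (mono-≢ _ e n n≢e)))

mono-neg : ∀ c e → mono (- c) e ≋ negS (mono c e)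
mono-neg c e n = by-cases (n N.≟ e)
  where
  by-cases : Dec (n ≡ e) → mono (- c) e n ≡ - mono c e n
  by-cases (yes refl) = trans (mono-≡ (- c) n) (cong -_ (sym (mono-≡ c n)))
  by-cases (no n≢e)   = trans (mono-≢ (- c) e n n≢e) (cong -_ (sym (mono-≢ c e n n≢e)))

q^_ : ℕ → FPS
q^ e = mono (+ 1) e

mono-suc≋delay : ∀ c e → mono c (suc e) ≋ delay (mono c e)
mono-suc≋delay c e zero    = refl
mono-suc≋delay c e (suc n) = mono-suc c e n

q^-+ : ∀ a b → q^ a ⊛ q^ b ≋ q^ (a + b)
q^-+ zero    b n       = ⊛-identityˡ (q^ b) n
q^-+ (suc a) b zero    = refl
q^-+ (suc a) b (suc n) =
  trans (⊛-congʳ≋ (q^ b) (mono-suc≋delay (+ 1) a) (suc n))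
        (trans (delay-⊛ (q^ a) (q^ b) n) (trans (q^-+ a b n) (sym (mono-suc (+ 1) (a + b) n))))

infix 4 q^_∣_
q^_∣_ : ℕ → FPS → Set
q^ d ∣ f = ∀ n → n < d → f n ≡ + 0

q^∣q^ : ∀ e → q^ e ∣ q^ e
q^∣q^ e n n<e = mono-≢ (+ 1) e n (λ n≡e → NP.<-irrefl n≡e n<e)

q^∣-⊛ʳ : ∀ {d f} g → q^ d ∣ f → q^ d ∣ f ⊛ g
q^∣-⊛ʳ g d∣f n n<d = sumTo-zeros n _ (λ i i≤n → cong (_*ℤ g (n ∸ i)) (d∣f i (NP.≤-<-trans i≤n n<d)))

q^∣-weaken : ∀ {d d′ f} → d′ ≤ d → q^ d ∣ f → q^ d′ ∣ f
q^∣-weaken d′≤d d∣f n n<d′ = d∣f n (NP.<-≤-trans n<d′ d′≤d)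

lookupD-invList : ∀ f n i → i ≤ n → lookupD (invList f n) i ≡ inv f (n ∸ i)
lookupD-invList f zero    zero    _         = refl
lookupD-invList f (suc n) zero    _         = refl
lookupD-invList f (suc n) (suc i) (s≤s i≤n) = lookupD-invList f n i i≤n

⊛-inv : ∀ f → f 0 ≡ + 1 → f ⊛ inv f ≋ oneS
⊛-inv f f₀≡1 zero    = cong (_*ℤ + 1) f₀≡1
⊛-inv f f₀≡1 (suc n) = trans (⊛-suc f (inv f) n)
  (trans (cong₂ _+ℤ_ (trans (cong (_*ℤ inv f (suc n)) f₀≡1) (ZP.*-identityˡ _))
                     (sumTo-cong n (λ i i≤n → cong (f (suc i) *ℤ_) (sym (lookupD-invList f n i i≤n)))))
         (ZP.+-inverseˡ (sumTo n (λ i → f (suc i) *ℤ lookupD (invList f n) i))))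

-- Agreement of coefficients up to q^N, i.e. equality in ℤ[q]/(q^(N+1))

infix 4 _≈[_]_
record _≈[_]_ (f : FPS) (N : ℕ) (g : FPS) : Set where
  constructor agree
  field coeff-≡ : ∀ n → n ≤ N → f n ≡ g n
open _≈[_]_ public

≋⇒≈ : ∀ {N f g} → f ≋ g → f ≈[ N ] g
≋⇒≈ f≋g = agree (λ n _ → f≋g n)

≈-refl : ∀ {N f} → f ≈[ N ] f
≈-refl = agree (λ _ _ → refl)

≈-trans : ∀ {N f g h} → f ≈[ N ] g → g ≈[ N ] h → f ≈[ N ] h
≈-trans (agree f≈g) (agree g≈h) = agree (λ n n≤N → trans (f≈g n n≤N) (g≈h n n≤N))

⊛-cong-≈ : ∀ {N f f′ g g′} → f ≈[ N ] f′ → g ≈[ N ] g′ → f ⊛ g ≈[ N ] f′ ⊛ g′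
⊛-cong-≈ (agree f≈f′) (agree g≈g′) = agree (λ n n≤N → sumTo-cong n (λ i i≤n →
  cong₂ _*ℤ_ (f≈f′ i (NP.≤-trans i≤n n≤N)) (g≈g′ (n ∸ i) (NP.≤-trans (NP.m∸n≤m n i) n≤N))))

q^∣⇒≈0 : ∀ {N d f} → N < d → q^ d ∣ f → f ≈[ N ] zeroS
q^∣⇒≈0 N<d d∣f = agree (λ n n≤N → d∣f n (NP.≤-<-trans n≤N N<d))

-- Infinite products as limits of finite ones

poch-coeff₀ : ∀ s c d m → poch s (suc c) d m 0 ≡ + 1
poch-coeff₀ s c d zero    = refl
poch-coeff₀ s c d (suc m) = cong (_*ℤ (+ 1 +ℤ + 0)) (poch-coeff₀ s c d m)

poch-suc≈ : ∀ s c d m n → n < c + d * m → poch s c d (suc m) ≈[ n ] poch s c d m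
poch-suc≈ s c d m n n<e =
  ≈-trans (⊛-cong-≈ (≈-refl {f = poch s c d m}) factor≈1) (≋⇒≈ (⊛-identityʳ _))
  where
  factor≈1 : pochFactor s c d m ≈[ n ] oneS
  factor≈1 = agree (λ i i≤n →
    trans (cong (oneS i +ℤ_) (mono-≢ (- s) _ i (λ i≡e → NP.<-irrefl i≡e (NP.≤-<-trans i≤n n<e))))
                                     (ZP.+-identityʳ _))

poch-stable : ∀ s c d n J k → (∀ j → J ≤ j → n < c + d * j) → poch s c d (k + J) ≈[ n ] poch s c d J
poch-stable s c d n J zero    late = ≈-refl
poch-stable s c d n J (suc k) late =
  ≈-trans (poch-suc≈ s c d (k + J) n (late (k + J) (NP.m≤n+m J k))) (poch-stable s c d n J k late)

pochInf≈poch : ∀ s c d N M → N < M → pochInf s (suc c) (suc d) ≈[ N ] poch s (suc c) (suc d) M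
pochInf≈poch s c d N M N<M = agree λ n n≤N →
  sym (trans (cong (λ m → poch s (suc c) (suc d) m n) (sym (NP.m∸n+n≡m (NP.≤-trans (s≤s n≤N) N<M))))
             (coeff-≡ (poch-stable s (suc c) (suc d) n (suc n) (M ∸ suc n) (late n)) n NP.≤-refl))
  where
  late : ∀ n j → suc n ≤ j → n < suc c + suc d * j
  late n j n<j = s≤s (NP.≤-trans (NP.≤-trans (NP.n≤1+n n) n<j)
                                 (NP.≤-trans (NP.m≤m+n j (d * j)) (NP.m≤n+m _ c)))

evenPoch : ℕ → FPS
evenPoch = poch (+ 1) 2 2

negPoch∞ oddPoch∞ evenPoch∞ : FPS
negPoch∞  = pochInf (- + 1) 1 1
oddPoch∞  = pochInf (+ 1) 1 2
evenPoch∞ = pochInf (+ 1) 2 2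

-- Finite sums of series, and Euler's series Σ_(m<M) q^(cm) / (q²;q²)_m

finSum : ℕ → (ℕ → FPS) → FPS
finSum zero    t = zeroS
finSum (suc M) t = finSum M t ⊕ t M

finSum-coeff : ∀ M t n → finSum (suc M) t n ≡ sumTo M (λ j → t j n)
finSum-coeff zero    t n = ZP.+-identityˡ (t 0 n)
finSum-coeff (suc M) t n = cong (_+ℤ t (suc M) n) (finSum-coeff M t n)

infSum1-coeff : ∀ t M n → n ≤ M → (∀ j → q^ j ∣ t (suc j)) → infSum1 t n ≡ finSum (suc M) (t ∘ suc) n
infSum1-coeff t M n n≤M j∣t = sym (begin
  finSum (suc M) (t ∘ suc) n             ≡⟨ finSum-coeff M (t ∘ suc) n ⟩
  sumTo M (λ j → t (suc j) n)            ≡⟨ cong (λ b → sumTo b (λ j → t (suc j) n)) (sym (NP.m∸n+n≡m n≤M)) ⟩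
  sumTo (M ∸ n + n) (λ j → t (suc j) n)  ≡⟨ sumTo-pad n (M ∸ n) (λ j → t (suc j) n) (λ j n<j → j∣t j n n<j) ⟩
  sumTo n (λ j → t (suc j) n)            ∎)
  where open ≡-Reasoning

eulerTerm : ℕ → ℕ → FPS
eulerTerm c m = q^ (m * c) ⊛ inv (evenPoch m)

eulerSum : ℕ → ℕ → FPS
eulerSum c M = finSum M (eulerTerm c)

-- The substitution q ↦ q²

dil2-by-parity : FPS → ℕ → ℕ → ℤ
dil2-by-parity f m zero    = f (m DM./ 2)
dil2-by-parity f m (suc _) = + 0

dil2-unfold : ∀ f m → dil2 f m ≡ dil2-by-parity f m (m DM.% 2)
dil2-unfold f m with m DM.% 2
... | zero  = refl
... | suc _ = refl

dil2-suc-suc : ∀ f n → dil2 f (suc (suc n)) ≡ dil2 (shift f) n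
dil2-suc-suc f n = trans (dil2-unfold f (2 + n))
  (trans (cong (dil2-by-parity f (2 + n)) (trans (cong (DM._% 2) (NP.+-comm 2 n)) (DM.[m+n]%n≡m%n n 2)))
         (trans (by-parity (n DM.% 2)) (sym (dil2-unfold (shift f) n))))
  where
  by-parity : ∀ r → dil2-by-parity f (2 + n) r ≡ dil2-by-parity (shift f) n r
  by-parity zero    = cong f (DM.+-distrib-/-∣ˡ n (ND.∣-refl {2}))
  by-parity (suc r) = refl

dil2-cong : ∀ {f g} → f ≋ g → dil2 f ≋ dil2 g
dil2-cong {f} {g} f≋g m = trans (dil2-unfold f m) (trans (by-parity (m DM.% 2)) (sym (dil2-unfold g m)))
  where
  by-parity : ∀ r → dil2-by-parity f m r ≡ dil2-by-parity g m r
  by-parity zero    = f≋g (m DM./ 2)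
  by-parity (suc r) = refl

dil2-scale-⊕ : ∀ c f g → dil2 (scale c f ⊕ g) ≋ scale c (dil2 f) ⊕ dil2 g
dil2-scale-⊕ c f g m = trans (dil2-unfold _ m)
  (trans (by-parity (m DM.% 2)) (sym (cong₂ (λ a b → c *ℤ a +ℤ b) (dil2-unfold f m) (dil2-unfold g m))))
  where
  by-parity : ∀ r → dil2-by-parity (scale c f ⊕ g) m r ≡ c *ℤ dil2-by-parity f m r +ℤ dil2-by-parity g m r
  by-parity zero    = refl
  by-parity (suc r) = sym (cong (_+ℤ + 0) (ZP.*-zeroʳ c))

dil2-⊕ : ∀ f g → dil2 (f ⊕ g) ≋ dil2 f ⊕ dil2 g
dil2-⊕ f g m =
  trans (dil2-cong (λ n → cong (_+ℤ g n) (sym (ZP.*-identityˡ (f n)))) m)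
        (trans (dil2-scale-⊕ (+ 1) f g m) (cong (_+ℤ dil2 g m) (ZP.*-identityˡ (dil2 f m))))

dil2-⊛ : ∀ f g → dil2 f ⊛ dil2 g ≋ dil2 (f ⊛ g)
dil2-⊛ f g zero          = refl
dil2-⊛ f g (suc zero)    = trans (⊛-suc (dil2 f) (dil2 g) 0)
  (trans (cong (_+ℤ (shift (dil2 f) ⊛ dil2 g) 0) (ZP.*-zeroʳ (f 0))) (ZP.*-zeroˡ (dil2 g 0)))
dil2-⊛ f g (suc (suc n)) = begin
  (dil2 f ⊛ dil2 g) (2 + n)
    ≡⟨ ⊛-suc (dil2 f) (dil2 g) (suc n) ⟩
  f 0 *ℤ dil2 g (2 + n) +ℤ (shift (dil2 f) ⊛ dil2 g) (suc n)
    ≡⟨ cong₂ (λ a b → f 0 *ℤ a +ℤ b) (dil2-suc-suc g n) odd-part ⟩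
  f 0 *ℤ dil2 (shift g) n +ℤ dil2 (shift f ⊛ g) n
    ≡⟨ sym (dil2-scale-⊕ (f 0) (shift g) (shift f ⊛ g) n) ⟩
  dil2 (scale (f 0) (shift g) ⊕ shift f ⊛ g) n
    ≡⟨ sym (dil2-cong (⊛-suc f g) n) ⟩
  dil2 (shift (f ⊛ g)) n
    ≡⟨ sym (dil2-suc-suc (f ⊛ g) n) ⟩
  dil2 (f ⊛ g) (2 + n) ∎
  where
  open ≡-Reasoning
  shift-dil2 : shift (dil2 f) ≋ delay (dil2 (shift f))
  shift-dil2 zero    = refl
  shift-dil2 (suc m) = dil2-suc-suc f m
  odd-part : (shift (dil2 f) ⊛ dil2 g) (suc n) ≡ dil2 (shift f ⊛ g) n
  odd-part = trans (⊛-congʳ≋ (dil2 g) shift-dil2 (suc n))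
                   (trans (delay-⊛ (dil2 (shift f)) (dil2 g) n) (dil2-⊛ (shift f) g n))

dil2-zeroS : dil2 zeroS ≋ zeroS
dil2-zeroS m with m DM.% 2
... | zero  = refl
... | suc _ = refl

dil2-delay : ∀ f → dil2 (delay f) ≋ delay (delay (dil2 f))
dil2-delay f zero          = refl
dil2-delay f (suc zero)    = refl
dil2-delay f (suc (suc n)) = dil2-suc-suc (delay f) n

dil2-mono : ∀ c e → dil2 (mono c e) ≋ mono c (e + e)
dil2-mono c zero    zero          = refl
dil2-mono c zero    (suc zero)    = refl
dil2-mono c zero    (suc (suc n)) = trans (dil2-suc-suc (mono c 0) n) (dil2-zeroS n)
dil2-mono c (suc e) n             = begin
  dil2 (mono c (suc e)) n            ≡⟨ dil2-cong (mono-suc≋delay c e) n ⟩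
  dil2 (delay (mono c e)) n          ≡⟨ dil2-delay (mono c e) n ⟩
  delay (delay (dil2 (mono c e))) n  ≡⟨ delay-cong (delay-cong (dil2-mono c e)) n ⟩
  delay (delay (mono c (e + e))) n   ≡⟨ sym (delay-cong (mono-suc≋delay c (e + e)) n) ⟩
  delay (mono c (suc (e + e))) n     ≡⟨ sym (mono-suc≋delay c (suc (e + e)) n) ⟩
  mono c (suc (suc (e + e))) n       ≡⟨ cong (λ d → mono c (suc d) n) (sym (NP.+-suc e e)) ⟩
  mono c (suc e + suc e) n           ∎
  where open ≡-Reasoning

double-1+m : ∀ m → (1 + 1 * m) + (1 + 1 * m) ≡ 2 + 2 * m
double-1+m m = solve 1 (λ m → (con 1 :+ con 1 :* m) :+ (con 1 :+ con 1 :* m) := con 2 :+ con 2 :* m) refl m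
  where open ℕ-Solver

dil2-pochFactor : ∀ j → dil2 (pochFactor (+ 1) 1 1 j) ≋ pochFactor (+ 1) 2 2 j
dil2-pochFactor j n = begin
  dil2 (oneS ⊕ mono (- + 1) (suc j′)) n
    ≡⟨ dil2-⊕ oneS _ n ⟩
  dil2 oneS n +ℤ dil2 (mono (- + 1) (suc j′)) n
    ≡⟨ cong (dil2 oneS n +ℤ_) (dil2-mono (- + 1) (suc j′) n) ⟩
  dil2 oneS n +ℤ mono (- + 1) (suc j′ + suc j′) n
    ≡⟨ cong₂ _+ℤ_ (dil2-mono (+ 1) 0 n) (cong (λ e → mono (- + 1) e n) (double-1+m j)) ⟩
  oneS n +ℤ mono (- + 1) (2 + 2 * j) n ∎
  where
  open ≡-Reasoning
  j′ : ℕ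
  j′ = 1 * j

dil2-poch : ∀ m → dil2 (poch (+ 1) 1 1 m) ≋ evenPoch m
dil2-poch zero      = dil2-mono (+ 1) 0
dil2-poch (suc m) n =
  trans (sym (dil2-⊛ (poch (+ 1) 1 1 m) (pochFactor (+ 1) 1 1 m) n))
        (trans (⊛-congʳ≋ (dil2 (pochFactor (+ 1) 1 1 m)) (dil2-poch m) n) (⊛-congˡ≋ (evenPoch m) (dil2-pochFactor m) n))

gauss-vanishes : ∀ n k → n < k → gauss n k ≡ zeroS
gauss-vanishes n k n<k with k N.≤? n
... | yes k≤n = ⊥-elim (NP.<⇒≱ n<k k≤n)
... | no _    = refl

T-suc : ∀ n → T (suc n) ≡ T n + suc n
T-suc n = trans (cong (DM._/ 2) expand)
  (trans (DM.+-distrib-/-∣ʳ (n * suc n) (ND.n∣m*n (suc n))) (cong (_+_ (T n)) (DM.m*n/n≡m (suc n) 2)))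
  where
  open ℕ-Solver
  expand : suc n * suc (suc n) ≡ n * suc n + suc n * 2
  expand = solve 1 (λ n → (con 1 :+ n) :* (con 2 :+ n) := n :* (con 1 :+ n) :+ (con 1 :+ n) :* con 2) refl n

twice-T : ∀ n → 2 * T n ≡ n * suc n
twice-T zero    = refl
twice-T (suc n) = begin
  2 * T (suc n)          ≡⟨ cong (2 *_) (T-suc n) ⟩
  2 * (T n + suc n)      ≡⟨ NP.*-distribˡ-+ 2 (T n) (suc n) ⟩
  2 * T n + 2 * suc n    ≡⟨ cong (_+ 2 * suc n) (twice-T n) ⟩
  n * suc n + 2 * suc n  ≡⟨ sym (NP.*-distribʳ-+ (suc n) n 2) ⟩
  (n + 2) * suc n        ≡⟨ cong (_* suc n) (NP.+-comm n 2) ⟩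
  suc (suc n) * suc n    ≡⟨ NP.*-comm (suc (suc n)) (suc n) ⟩
  suc n * suc (suc n)    ∎
  where open ≡-Reasoning

half-double : ∀ k → (2 * k) DM./ 2 ≡ k
half-double k = trans (cong (DM._/ 2) (NP.*-comm 2 k)) (DM.m*n/n≡m k 2)

half-suc-double : ∀ k → suc (2 * k) DM./ 2 ≡ k
half-suc-double k = trans (DM.+-distrib-/-∣ʳ 1 {2 * k} {2} (ND.m∣m*n {2} k)) (half-double k)

twice-G-even : ∀ k → 2 * G (2 * k) ≡ k * suc (3 * k)
twice-G-even k = begin
  2 * (T (2 * k) ∸ T ((2 * k) DM./ 2))     ≡⟨ cong (λ h → 2 * (T (2 * k) ∸ T h)) (half-double k) ⟩
  2 * (T (2 * k) ∸ T k)                    ≡⟨ NP.*-distribˡ-∸ 2 (T (2 * k)) (T k) ⟩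
  2 * T (2 * k) ∸ 2 * T k                  ≡⟨ cong₂ _∸_ (twice-T (2 * k)) (twice-T k) ⟩
  2 * k * suc (2 * k) ∸ k * suc k          ≡⟨ cong (_∸ k * suc k) split ⟩
  k * suc k + k * suc (3 * k) ∸ k * suc k  ≡⟨ NP.m+n∸m≡n (k * suc k) _ ⟩
  k * suc (3 * k)                          ∎
  where
  open ≡-Reasoning
  split : 2 * k * suc (2 * k) ≡ k * suc k + k * suc (3 * k)
  split = ℕ-Solver.solve 1 (λ k → con 2 :* k :* (con 1 :+ con 2 :* k)
                                  := k :* (con 1 :+ k) :+ k :* (con 1 :+ con 3 :* k)) refl k
    where open ℕ-Solver

twice-G-odd : ∀ k → 2 * G (suc (2 * k)) ≡ suc k * (2 + 3 * k)
twice-G-odd k = begin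
  2 * (T (suc (2 * k)) ∸ T (suc (2 * k) DM./ 2))  ≡⟨ cong (λ h → 2 * (T (suc (2 * k)) ∸ T h)) (half-suc-double k) ⟩
  2 * (T (suc (2 * k)) ∸ T k)                     ≡⟨ NP.*-distribˡ-∸ 2 (T (suc (2 * k))) (T k) ⟩
  2 * T (suc (2 * k)) ∸ 2 * T k                   ≡⟨ cong₂ _∸_ (twice-T (suc (2 * k))) (twice-T k) ⟩
  suc (2 * k) * suc (suc (2 * k)) ∸ k * suc k     ≡⟨ cong (_∸ k * suc k) split ⟩
  k * suc k + suc k * (2 + 3 * k) ∸ k * suc k     ≡⟨ NP.m+n∸m≡n (k * suc k) _ ⟩
  suc k * (2 + 3 * k)                             ∎
  where
  open ≡-Reasoning
  split : suc (2 * k) * suc (suc (2 * k)) ≡ k * suc k + suc k * (2 + 3 * k)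
  split = ℕ-Solver.solve 1 (λ k → (con 1 :+ con 2 :* k) :* (con 2 :+ con 2 :* k)
                                  := k :* (con 1 :+ k) :+ (con 1 :+ k) :* (con 2 :+ con 3 :* k)) refl k
    where open ℕ-Solver

negOnePow-+-even : ∀ a b → negOnePow (a + 2 * b) ≡ negOnePow a
negOnePow-+-even a zero    = cong negOnePow (NP.+-identityʳ a)
negOnePow-+-even a (suc b) =
  trans (cong negOnePow (trans (NP.+-suc a _) (cong suc (trans (cong (_+_ a) (NP.+-suc b (b + 0))) (NP.+-suc a _)))))
        (trans (ZP.neg-involutive _) (negOnePow-+-even a b))

negOnePow-T-even : ∀ k → negOnePow (T (2 * k)) ≡ negOnePow k
negOnePow-T-even k = trans (cong negOnePow T-even) (negOnePow-+-even k (k * k))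
  where
  T-even : T (2 * k) ≡ k + 2 * (k * k)
  T-even = NP.*-cancelˡ-≡ _ _ 2 (trans (twice-T (2 * k))
    (ℕ-Solver.solve 1 (λ k → (con 2 :* k) :* (con 1 :+ con 2 :* k) := con 2 :* (k :+ con 2 :* (k :* k))) refl k))
    where open ℕ-Solver

negOnePow-T-odd : ∀ k → negOnePow (T (suc (2 * k))) ≡ negOnePow (suc k)
negOnePow-T-odd k = trans (cong negOnePow T-odd) (negOnePow-+-even (suc k) (k * suc k))
  where
  T-odd : T (suc (2 * k)) ≡ suc k + 2 * (k * suc k)
  T-odd = NP.*-cancelˡ-≡ _ _ 2 (trans (twice-T (suc (2 * k)))
    (ℕ-Solver.solve 1 (λ k → (con 1 :+ con 2 :* k) :* (con 2 :+ con 2 :* k)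
                             := con 2 :* ((con 1 :+ k) :+ con 2 :* (k :* (con 1 :+ k)))) refl k))
    where open ℕ-Solver

pentagonalTerm : ℕ → FPS
pentagonalTerm n = mono (negOnePow (T n)) (2 * G n)

pentagonalSum : ℕ → FPS
pentagonalSum k n = sumTo (2 * k ∸ 1) (λ j → pentagonalTerm j n)

pentagonalSum-suc : ∀ k → pentagonalSum (suc (suc k))
                          ≋ pentagonalSum (suc k) ⊕ pentagonalTerm (2 * suc k) ⊕ pentagonalTerm (suc (2 * suc k))
pentagonalSum-suc k n = cong (λ i → sumTo i (λ j → pentagonalTerm j n)) (cong suc (NP.+-suc k (suc (k + 0))))

-- Exponents in the summands of S_(k+1) and S_(k+2)

exponent-head : ∀ k → suc k * k + 2 * suc (suc k) * (suc k + 0) ≡ suc k * suc (3 * suc k)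
exponent-head k = solve 1 (λ k → (con 1 :+ k) :* k :+ con 2 :* (con 2 :+ k) :* ((con 1 :+ k) :+ con 0)
                               := (con 1 :+ k) :* (con 1 :+ con 3 :* (con 1 :+ k))) refl k
  where open ℕ-Solver

module _ (k m : ℕ) where
  open ℕ-Solver

  exponent-U : suc k * suc (3 * suc k) + suc m * (2 + 2 * suc k)
               ≡ suc k * k + 2 * suc (suc k) * (suc k + suc m)
  exponent-U = solve 2 (λ k m → (con 1 :+ k) :* (con 1 :+ con 3 :* (con 1 :+ k))
                                   :+ (con 1 :+ m) :* (con 2 :+ con 2 :* (con 1 :+ k))
                                := (con 1 :+ k) :* k :+ con 2 :* (con 2 :+ k) :* ((con 1 :+ k) :+ (con 1 :+ m))) refl k m

  exponent-V : suc (suc k) * (2 + 3 * suc k) + m * (2 + 2 * suc k)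
               ≡ suc k * k + 2 * suc (suc k) * (suc k + suc m) + (2 + 2 * k)
  exponent-V = solve 2 (λ k m → (con 2 :+ k) :* (con 2 :+ con 3 :* (con 1 :+ k)) :+ m :* (con 2 :+ con 2 :* (con 1 :+ k))
                                := (con 1 :+ k) :* k :+ con 2 :* (con 2 :+ k) :* ((con 1 :+ k) :+ (con 1 :+ m))
                                   :+ (con 2 :+ con 2 :* k)) refl k m

  exponent-b : suc (suc k) * suc k + 2 * suc (suc (suc k)) * (suc (suc k) + m)
               ≡ suc k * k + 2 * suc (suc k) * (suc k + suc m) + (2 + 2 * m) + (2 + 2 * k) + (2 + 2 * k)
  exponent-b = solve 2 (λ k m → (con 2 :+ k) :* (con 1 :+ k) :+ con 2 :* (con 3 :+ k) :* ((con 2 :+ k) :+ m)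
                                := (con 1 :+ k) :* k :+ con 2 :* (con 2 :+ k) :* ((con 1 :+ k) :+ (con 1 :+ m))
                                   :+ (con 2 :+ con 2 :* m) :+ (con 2 :+ con 2 :* k) :+ (con 2 :+ con 2 :* k)) refl k m

  exponent-W : 2 + 2 * (suc k + m) ≡ (2 + 2 * m) + (2 + 2 * k)
  exponent-W = solve 2 (λ k m → con 2 :+ con 2 :* ((con 1 :+ k) :+ m) := (con 2 :+ con 2 :* m) :+ (con 2 :+ con 2 :* k)) refl k m

-- The ring ℤ[q]/(q^(N+1))

module Truncated (N : ℕ) where

  open import Algebra.Bundles using (CommutativeRing)
  open import Algebra.Structures using (IsCommutativeRing)
  open import Algebra.Solver.Ring.AlmostCommutativeRing using (fromCommutativeRing; _-Raw-AlmostCommutative⟶_)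
  import Algebra.Solver.Ring
  open import Level using (0ℓ)
  open import Data.Product using (_,_)
  open import Data.Maybe using (Maybe; just; nothing)

  infix 4 _≈_
  _≈_ : FPS → FPS → Set
  f ≈ g = f ≈[ N ] g

  isCommutativeRing : IsCommutativeRing _≈_ _⊕_ _⊛_ negS zeroS oneS
  isCommutativeRing = record
    { isRing = record
      { +-isAbelianGroup = record
        { isGroup = record
          { isMonoid = record
            { isSemigroup = record
              { isMagma = record
                { isEquivalence = record
                  { refl  = ≈-refl
                  ; sym   = λ (agree f≈g) → agree (λ n n≤N → sym (f≈g n n≤N))
                  ; trans = ≈-trans }
                ; ∙-cong = λ (agree f≈f′) (agree g≈g′) →
                             agree (λ n n≤N → cong₂ _+ℤ_ (f≈f′ n n≤N) (g≈g′ n n≤N)) }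
              ; assoc = λ f g h → ≋⇒≈ (λ n → ZP.+-assoc (f n) (g n) (h n)) }
            ; identity = (λ f → ≋⇒≈ (λ n → ZP.+-identityˡ (f n)))
                       , (λ f → ≋⇒≈ (λ n → ZP.+-identityʳ (f n))) }
          ; inverse = (λ f → ≋⇒≈ (λ n → ZP.+-inverseˡ (f n))) , (λ f → ≋⇒≈ (λ n → ZP.+-inverseʳ (f n)))
          ; ⁻¹-cong = λ (agree f≈g) → agree (λ n n≤N → cong -_ (f≈g n n≤N)) }
        ; comm = λ f g → ≋⇒≈ (λ n → ZP.+-comm (f n) (g n)) }
      ; *-cong = ⊛-cong-≈
      ; *-assoc = λ f g h → ≋⇒≈ (⊛-assoc f g h)
      ; *-identity = (λ f → ≋⇒≈ (⊛-identityˡ f)) , (λ f → ≋⇒≈ (⊛-identityʳ f))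
      ; distrib = (λ f g h → ≋⇒≈ (⊛-distribˡ-⊕ f g h)) , (λ f g h → ≋⇒≈ (⊛-distribʳ-⊕ g h f)) }
    ; *-comm = λ f g → ≋⇒≈ (⊛-comm f g) }

  ring : CommutativeRing 0ℓ 0ℓ
  ring = record { isCommutativeRing = isCommutativeRing }

  open CommutativeRing ring public
    using (setoid; +-cong; *-cong; -‿cong; +-assoc; +-identityˡ; +-identityʳ; -‿inverseʳ; *-assoc; *-comm; zeroʳ)
    renaming (sym to ≈-sym; reflexive to ≈-reflexive)

  cst : ℤ → FPS
  cst c = mono c 0

  private
    cst-homomorphism : CommutativeRing.rawRing ZP.+-*-commutativeRing -Raw-AlmostCommutative⟶ fromCommutativeRing ring
    cst-homomorphism = record
      { ⟦_⟧    = cst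
      ; +-homo = λ a b → agree λ { zero _ → refl ; (suc n) _ → refl }
      ; *-homo = λ a b → ≋⇒≈ (λ n → sym (trans (scale-as-⊛ a (cst b) n) (scale-mono a b 0 n)))
      ; -‿homo = λ a → agree λ { zero _ → refl ; (suc n) _ → refl }
      ; 0-homo = agree λ { zero _ → refl ; (suc n) _ → refl }
      ; 1-homo = ≈-refl }

    cst-≟ : ∀ a b → Maybe (cst a ≈ cst b)
    cst-≟ a b with a Z.≟ b
    ... | yes refl = just ≈-refl
    ... | no _     = nothing

  open Algebra.Solver.Ring (CommutativeRing.rawRing ZP.+-*-commutativeRing) (fromCommutativeRing ring) cst-homomorphism cst-≟
    public using (solve; _:=_; _:+_; _:*_; :-_; con)

  open import Relation.Binary.Reasoning.Setoid setoid

  ⊛-congˡ : ∀ f {g g′} → g ≈ g′ → f ⊛ g ≈ f ⊛ g′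
  ⊛-congˡ f = *-cong (≈-refl {f = f})

  ⊛-congʳ : ∀ {f f′} g → f ≈ f′ → f ⊛ g ≈ f′ ⊛ g
  ⊛-congʳ g f≈f′ = *-cong f≈f′ (≈-refl {f = g})

  ⊕-congˡ : ∀ f {g g′} → g ≈ g′ → f ⊕ g ≈ f ⊕ g′
  ⊕-congˡ f = +-cong (≈-refl {f = f})

  ⊕-congʳ : ∀ {f f′} g → f ≈ f′ → f ⊕ g ≈ f′ ⊕ g
  ⊕-congʳ g f≈f′ = +-cong f≈f′ (≈-refl {f = g})

  q^-cong : ∀ {a b} → a ≡ b → q^ a ≈ q^ b
  q^-cong a≡b = ≈-reflexive (cong q^_ a≡b)

  q^-+≈ : ∀ a b → q^ (a + b) ≈ q^ a ⊛ q^ b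
  q^-+≈ a b = ≈-sym (≋⇒≈ (q^-+ a b))

  pochFactor≈1-q^ : ∀ c d j → pochFactor (+ 1) c d j ≈ oneS ⊕ negS (q^ (c + d * j))
  pochFactor≈1-q^ c d j = ⊕-congˡ oneS (≋⇒≈ (mono-neg (+ 1) _))

  inv-unique : ∀ f g → f 0 ≡ + 1 → f ⊛ g ≈ oneS → g ≈ inv f
  inv-unique f g f₀≡1 fg≈1 = begin
    g                ≈⟨ ≈-sym (≋⇒≈ (⊛-identityʳ g)) ⟩
    g ⊛ oneS         ≈⟨ ⊛-congˡ g (≈-sym (≋⇒≈ (⊛-inv f f₀≡1))) ⟩
    g ⊛ (f ⊛ inv f)  ≈⟨ ≈-sym (*-assoc g f (inv f)) ⟩
    (g ⊛ f) ⊛ inv f  ≈⟨ ⊛-congʳ (inv f) (≈-trans (*-comm g f) fg≈1) ⟩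
    oneS ⊛ inv f     ≈⟨ ≋⇒≈ (⊛-identityˡ (inv f)) ⟩
    inv f            ∎

  ⊛-cancelʳ : ∀ f g h → h 0 ≡ + 1 → f ⊛ h ≈ g ⊛ h → f ≈ g
  ⊛-cancelʳ f g h h₀≡1 fh≈gh = begin
    f                ≈⟨ ≈-sym (≋⇒≈ (⊛-identityʳ f)) ⟩
    f ⊛ oneS         ≈⟨ ⊛-congˡ f (≈-sym (≋⇒≈ (⊛-inv h h₀≡1))) ⟩
    f ⊛ (h ⊛ inv h)  ≈⟨ ≈-sym (*-assoc f h (inv h)) ⟩
    (f ⊛ h) ⊛ inv h  ≈⟨ ⊛-congʳ (inv h) fh≈gh ⟩
    (g ⊛ h) ⊛ inv h  ≈⟨ *-assoc g h (inv h) ⟩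
    g ⊛ (h ⊛ inv h)  ≈⟨ ⊛-congˡ g (≋⇒≈ (⊛-inv h h₀≡1)) ⟩
    g ⊛ oneS         ≈⟨ ≋⇒≈ (⊛-identityʳ g) ⟩
    g                ∎

  inv-cong : ∀ f g → f 0 ≡ + 1 → g 0 ≡ + 1 → f ≈ g → inv f ≈ inv g
  inv-cong f g f₀≡1 g₀≡1 f≈g =
    inv-unique g (inv f) g₀≡1 (≈-trans (⊛-congʳ (inv f) (≈-sym f≈g)) (≋⇒≈ (⊛-inv f f₀≡1)))

  inv-oneS : inv oneS ≈ oneS
  inv-oneS = ≈-sym (inv-unique oneS oneS refl (≋⇒≈ (⊛-identityˡ oneS)))

  dil2-inv : ∀ f → f 0 ≡ + 1 → dil2 (inv f) ≈ inv (dil2 f)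
  dil2-inv f f₀≡1 = inv-unique (dil2 f) (dil2 (inv f)) f₀≡1 (≋⇒≈ (λ n →
    trans (dil2-⊛ f (inv f) n) (trans (dil2-cong (⊛-inv f f₀≡1) n) (dil2-mono (+ 1) 0 n))))

  negPoch-⊛-poch : ∀ m → poch (- + 1) 1 1 m ⊛ poch (+ 1) 1 1 m ≈ evenPoch m
  negPoch-⊛-poch zero    = ≋⇒≈ (⊛-identityˡ oneS)
  negPoch-⊛-poch (suc m) = begin
    (poch (- + 1) 1 1 m ⊛ pochFactor (- + 1) 1 1 m) ⊛ (poch (+ 1) 1 1 m ⊛ pochFactor (+ 1) 1 1 m)
      ≈⟨ interchange (poch (- + 1) 1 1 m) (pochFactor (- + 1) 1 1 m) (poch (+ 1) 1 1 m) (pochFactor (+ 1) 1 1 m) ⟩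
    (poch (- + 1) 1 1 m ⊛ poch (+ 1) 1 1 m) ⊛ (pochFactor (- + 1) 1 1 m ⊛ pochFactor (+ 1) 1 1 m)
      ≈⟨ *-cong (negPoch-⊛-poch m) (⊛-congˡ (oneS ⊕ mono (- - + 1) e) (pochFactor≈1-q^ 1 1 m)) ⟩
    evenPoch m ⊛ ((oneS ⊕ mono (- - + 1) e) ⊛ (oneS ⊕ negS (q^ e)))
      ≈⟨ ⊛-congˡ (evenPoch m) (difference-of-squares (q^ e)) ⟩
    evenPoch m ⊛ (oneS ⊕ negS (q^ e ⊛ q^ e))
      ≈⟨ ⊛-congˡ (evenPoch m) (⊕-congˡ oneS (-‿cong (≈-trans (≋⇒≈ (q^-+ e e)) (q^-cong (double-1+m m))))) ⟩
    evenPoch m ⊛ (oneS ⊕ negS (q^ (2 + 2 * m)))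
      ≈⟨ ⊛-congˡ (evenPoch m) (≈-sym (pochFactor≈1-q^ 2 2 m)) ⟩
    evenPoch (suc m) ∎
    where
    e : ℕ
    e = 1 + 1 * m
    interchange : ∀ a b c d → (a ⊛ b) ⊛ (c ⊛ d) ≈ (a ⊛ c) ⊛ (b ⊛ d)
    interchange = solve 4 (λ a b c d → (a :* b) :* (c :* d) := (a :* c) :* (b :* d)) ≈-refl
    difference-of-squares : ∀ X → (oneS ⊕ X) ⊛ (oneS ⊕ negS X) ≈ oneS ⊕ negS (X ⊛ X)
    difference-of-squares = solve 1 (λ X → (con (+ 1) :+ X) :* (con (+ 1) :+ :- X) := con (+ 1) :+ :- (X :* X)) ≈-refl

  poch-split-parity : ∀ m → poch (+ 1) 1 1 (2 * m) ≈ poch (+ 1) 1 2 m ⊛ evenPoch m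
  poch-split-parity zero    = ≈-sym (≋⇒≈ (⊛-identityˡ oneS))
  poch-split-parity (suc m) = begin
    poch (+ 1) 1 1 (2 * suc m)
      ≈⟨ ≈-reflexive (cong (poch (+ 1) 1 1) (cong suc (NP.+-suc m (m + 0)))) ⟩
    (poch (+ 1) 1 1 (2 * m) ⊛ pochFactor (+ 1) 1 1 (2 * m)) ⊛ pochFactor (+ 1) 1 1 (suc (2 * m))
      ≈⟨ *-cong (*-cong (poch-split-parity m) (factor-cong (cong suc (NP.*-identityˡ (2 * m)))))
                (factor-cong (cong suc (NP.*-identityˡ (suc (2 * m))))) ⟩
    ((odd ⊛ evenPoch m) ⊛ pochFactor (+ 1) 1 2 m) ⊛ pochFactor (+ 1) 2 2 m
      ≈⟨ regroup odd (evenPoch m) (pochFactor (+ 1) 1 2 m) (pochFactor (+ 1) 2 2 m) ⟩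
    poch (+ 1) 1 2 (suc m) ⊛ evenPoch (suc m) ∎
    where
    odd : FPS
    odd = poch (+ 1) 1 2 m
    factor-cong : ∀ {e e′} → e ≡ e′ → oneS ⊕ mono (- + 1) e ≈ oneS ⊕ mono (- + 1) e′
    factor-cong e≡e′ = ≈-reflexive (cong (λ e → oneS ⊕ mono (- + 1) e) e≡e′)
    regroup : ∀ a b c d → ((a ⊛ b) ⊛ c) ⊛ d ≈ (a ⊛ c) ⊛ (b ⊛ d)
    regroup = solve 4 (λ a b c d → ((a :* b) :* c) :* d := (a :* c) :* (b :* d)) ≈-refl

  negPoch∞-⊛-oddPoch∞ : negPoch∞ ⊛ oddPoch∞ ≈ oneS
  negPoch∞-⊛-oddPoch∞ = ⊛-cancelʳ (negPoch∞ ⊛ oddPoch∞) oneS evenPoch∞ (poch-coeff₀ (+ 1) 1 2 1) (begin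
    (negPoch∞ ⊛ oddPoch∞) ⊛ evenPoch∞
      ≈⟨ *-cong (*-cong (pochInf≈poch (- + 1) 0 0 N (2 * M) N<2M) (pochInf≈poch (+ 1) 0 1 N M NP.≤-refl))
                (pochInf≈poch (+ 1) 1 1 N M NP.≤-refl) ⟩
    (poch (- + 1) 1 1 (2 * M) ⊛ poch (+ 1) 1 2 M) ⊛ evenPoch M
      ≈⟨ *-assoc (poch (- + 1) 1 1 (2 * M)) (poch (+ 1) 1 2 M) (evenPoch M) ⟩
    poch (- + 1) 1 1 (2 * M) ⊛ (poch (+ 1) 1 2 M ⊛ evenPoch M)
      ≈⟨ ⊛-congˡ (poch (- + 1) 1 1 (2 * M)) (≈-sym (poch-split-parity M)) ⟩
    poch (- + 1) 1 1 (2 * M) ⊛ poch (+ 1) 1 1 (2 * M)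
      ≈⟨ negPoch-⊛-poch (2 * M) ⟩
    evenPoch (2 * M)
      ≈⟨ ≈-sym (pochInf≈poch (+ 1) 1 1 N (2 * M) N<2M) ⟩
    evenPoch∞
      ≈⟨ ≈-sym (≋⇒≈ (⊛-identityˡ evenPoch∞)) ⟩
    oneS ⊛ evenPoch∞ ∎)
    where
    M : ℕ
    M = suc N
    N<2M : N < 2 * M
    N<2M = NP.m≤m+n M (M + 0)

  A≈evenPoch∞-⊛-negPoch∞ : A ≈ evenPoch∞ ⊛ negPoch∞
  A≈evenPoch∞-⊛-negPoch∞ = ⊛-congˡ evenPoch∞ (≈-sym (inv-unique oddPoch∞ negPoch∞ (poch-coeff₀ (+ 1) 0 2 1)
    (≈-trans (*-comm oddPoch∞ negPoch∞) negPoch∞-⊛-oddPoch∞)))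

  finSum-cong : ∀ M {f g} → (∀ m → m < M → f m ≈ g m) → finSum M f ≈ finSum M g
  finSum-cong zero    f≈g = ≈-refl
  finSum-cong (suc M) f≈g = +-cong (finSum-cong M (λ m m<M → f≈g m (NP.m≤n⇒m≤1+n m<M))) (f≈g M NP.≤-refl)

  finSum-+ : ∀ a M t → finSum (a + M) t ≈ finSum a t ⊕ finSum M (λ m → t (a + m))
  finSum-+ a zero    t =
    ≈-trans (≈-reflexive (cong (λ b → finSum b t) (NP.+-identityʳ a))) (≈-sym (+-identityʳ (finSum a t)))
  finSum-+ a (suc M) t = begin
    finSum (a + suc M) t                                   ≈⟨ ≈-reflexive (cong (λ b → finSum b t) (NP.+-suc a M)) ⟩
    finSum (a + M) t ⊕ t (a + M)                           ≈⟨ ⊕-congʳ (t (a + M)) (finSum-+ a M t) ⟩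
    (finSum a t ⊕ finSum M (λ m → t (a + m))) ⊕ t (a + M)  ≈⟨ +-assoc (finSum a t) _ (t (a + M)) ⟩
    finSum a t ⊕ finSum (suc M) (λ m → t (a + m))          ∎

  ⊛-finSum : ∀ M c f → c ⊛ finSum M f ≈ finSum M (λ m → c ⊛ f m)
  ⊛-finSum zero    c f = zeroʳ c
  ⊛-finSum (suc M) c f =
    ≈-trans (≋⇒≈ (⊛-distribˡ-⊕ c (finSum M f) (f M))) (⊕-congʳ (c ⊛ f M) (⊛-finSum M c f))

  finSum-vanishing : ∀ a t → (∀ j → j < a → t j ≈ zeroS) → finSum a t ≈ zeroS
  finSum-vanishing zero    t t≈0 = ≈-refl
  finSum-vanishing (suc a) t t≈0 =
    ≈-trans (+-cong (finSum-vanishing a t (λ j j<a → t≈0 j (NP.m≤n⇒m≤1+n j<a))) (t≈0 a NP.≤-refl))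
            (+-identityʳ zeroS)

  finSum-drop : ∀ a M t → (∀ j → j < a → t j ≈ zeroS) → finSum (a + M) t ≈ finSum M (λ m → t (a + m))
  finSum-drop a M t t≈0 =
    ≈-trans (finSum-+ a M t) (≈-trans (⊕-congʳ _ (finSum-vanishing a t t≈0)) (+-identityˡ _))

  evenPoch-coeff₀ : ∀ m → evenPoch m 0 ≡ + 1
  evenPoch-coeff₀ = poch-coeff₀ (+ 1) 1 2

  evenPoch-⊛-inv : ∀ m → evenPoch m ⊛ inv (evenPoch m) ≈ oneS
  evenPoch-⊛-inv m = ≋⇒≈ (⊛-inv (evenPoch m) (evenPoch-coeff₀ m))

  evenPoch-+ : ∀ k j → evenPoch (k + j) ≈ evenPoch k ⊛ poch (+ 1) (2 + 2 * k) 2 j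
  evenPoch-+ k zero    =
    ≈-trans (≈-reflexive (cong evenPoch (NP.+-identityʳ k))) (≈-sym (≋⇒≈ (⊛-identityʳ (evenPoch k))))
  evenPoch-+ k (suc j) = begin
    evenPoch (k + suc j)
      ≈⟨ ≈-reflexive (cong evenPoch (NP.+-suc k j)) ⟩
    evenPoch (k + j) ⊛ pochFactor (+ 1) 2 2 (k + j)
      ≈⟨ *-cong (evenPoch-+ k j) (≈-reflexive (cong (λ e → oneS ⊕ mono (- + 1) e) exponent)) ⟩
    (evenPoch k ⊛ tail) ⊛ pochFactor (+ 1) (2 + 2 * k) 2 j
      ≈⟨ *-assoc (evenPoch k) tail (pochFactor (+ 1) (2 + 2 * k) 2 j) ⟩
    evenPoch k ⊛ poch (+ 1) (2 + 2 * k) 2 (suc j) ∎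
    where
    tail : FPS
    tail = poch (+ 1) (2 + 2 * k) 2 j
    exponent : 2 + 2 * (k + j) ≡ (2 + 2 * k) + 2 * j
    exponent = cong (_+_ 2) (NP.*-distribˡ-+ 2 k j)

  inv-evenPoch-suc : ∀ m → (oneS ⊕ negS (q^ (2 + 2 * m))) ⊛ inv (evenPoch (suc m)) ≈ inv (evenPoch m)
  inv-evenPoch-suc m = inv-unique (evenPoch m) (factor ⊛ inv (evenPoch (suc m))) (evenPoch-coeff₀ m) (begin
    evenPoch m ⊛ (factor ⊛ inv (evenPoch (suc m)))
      ≈⟨ ≈-sym (*-assoc (evenPoch m) factor (inv (evenPoch (suc m)))) ⟩
    (evenPoch m ⊛ factor) ⊛ inv (evenPoch (suc m))
      ≈⟨ ⊛-congʳ (inv (evenPoch (suc m))) (⊛-congˡ (evenPoch m) (≈-sym (pochFactor≈1-q^ 2 2 m))) ⟩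
    evenPoch (suc m) ⊛ inv (evenPoch (suc m))
      ≈⟨ evenPoch-⊛-inv (suc m) ⟩
    oneS ∎)
    where
    factor : FPS
    factor = oneS ⊕ negS (q^ (2 + 2 * m))

  eulerTerm-difference : ∀ c m → eulerTerm c (suc m) ⊕ negS (eulerTerm (c + 2) (suc m)) ≈ q^ c ⊛ eulerTerm c m
  eulerTerm-difference c m = begin
    x ⊛ i ⊕ negS (q^ (suc m * (c + 2)) ⊛ i)
      ≈⟨ ⊕-congˡ (x ⊛ i) (-‿cong (⊛-congʳ i (≈-trans (q^-cong exponent) (q^-+≈ (suc m * c) (2 + 2 * m))))) ⟩
    x ⊛ i ⊕ negS ((x ⊛ y) ⊛ i)
      ≈⟨ factor-out x y i ⟩
    x ⊛ ((oneS ⊕ negS y) ⊛ i)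
      ≈⟨ ⊛-congˡ x (inv-evenPoch-suc m) ⟩
    x ⊛ inv (evenPoch m)
      ≈⟨ ⊛-congʳ (inv (evenPoch m)) (q^-+≈ c (m * c)) ⟩
    (q^ c ⊛ q^ (m * c)) ⊛ inv (evenPoch m)
      ≈⟨ *-assoc (q^ c) (q^ (m * c)) (inv (evenPoch m)) ⟩
    q^ c ⊛ eulerTerm c m ∎
    where
    x y i : FPS
    x = q^ (suc m * c)
    y = q^ (2 + 2 * m)
    i = inv (evenPoch (suc m))
    exponent : suc m * (c + 2) ≡ suc m * c + (2 + 2 * m)
    exponent = trans (NP.*-distribˡ-+ (suc m) c 2) (cong (_+_ (suc m * c)) (cong (_+_ 2) (NP.*-comm m 2)))
    factor-out : ∀ a b i → a ⊛ i ⊕ negS ((a ⊛ b) ⊛ i) ≈ a ⊛ ((oneS ⊕ negS b) ⊛ i)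
    factor-out = solve 3 (λ a b i → a :* i :+ :- ((a :* b) :* i) := a :* ((con (+ 1) :+ :- b) :* i)) ≈-refl

  eulerSum-difference : ∀ c M → eulerSum c (suc M) ⊕ negS (eulerSum (c + 2) (suc M)) ≈ q^ c ⊛ eulerSum c M
  eulerSum-difference c zero    = ≈-trans (-‿inverseʳ (eulerSum c 1)) (≈-sym (zeroʳ (q^ c)))
  eulerSum-difference c (suc M) = begin
    (F ⊕ t) ⊕ negS (F′ ⊕ t′)                    ≈⟨ regroup F t F′ t′ ⟩
    (F ⊕ negS F′) ⊕ (t ⊕ negS t′)               ≈⟨ +-cong (eulerSum-difference c M) (eulerTerm-difference c M) ⟩
    q^ c ⊛ eulerSum c M ⊕ q^ c ⊛ eulerTerm c M  ≈⟨ ≈-sym (≋⇒≈ (⊛-distribˡ-⊕ (q^ c) (eulerSum c M) (eulerTerm c M))) ⟩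
    q^ c ⊛ eulerSum c (suc M)                   ∎
    where
    F F′ t t′ : FPS
    F  = eulerSum c (suc M)
    F′ = eulerSum (c + 2) (suc M)
    t  = eulerTerm c (suc M)
    t′ = eulerTerm (c + 2) (suc M)
    regroup : ∀ a b c d → (a ⊕ b) ⊕ negS (c ⊕ d) ≈ (a ⊕ negS c) ⊕ (b ⊕ negS d)
    regroup = solve 4 (λ a b c d → (a :+ b) :+ :- (c :+ d) := (a :+ :- c) :+ (b :+ :- d)) ≈-refl

  eulerSum-step : ∀ c M → N < suc M * c → (oneS ⊕ negS (q^ c)) ⊛ eulerSum c (suc M) ≈ eulerSum (c + 2) (suc M)
  eulerSum-step c M N<e = begin
    (oneS ⊕ negS (q^ c)) ⊛ (X ⊕ t)
      ≈⟨ expand (q^ c) X t ⟩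
    ((X ⊕ t) ⊕ negS (q^ c ⊛ X)) ⊕ negS (q^ c ⊛ t)
      ≈⟨ +-cong (⊕-congˡ (X ⊕ t) (-‿cong (≈-sym (eulerSum-difference c M)))) (-‿cong negligible) ⟩
    ((X ⊕ t) ⊕ negS ((X ⊕ t) ⊕ negS F′)) ⊕ negS zeroS
      ≈⟨ +-identityʳ _ ⟩
    (X ⊕ t) ⊕ negS ((X ⊕ t) ⊕ negS F′)
      ≈⟨ cancel (X ⊕ t) F′ ⟩
    F′ ∎
    where
    X t F′ : FPS
    X  = eulerSum c M
    t  = eulerTerm c M
    F′ = eulerSum (c + 2) (suc M)
    expand : ∀ x X t → (oneS ⊕ negS x) ⊛ (X ⊕ t) ≈ ((X ⊕ t) ⊕ negS (x ⊛ X)) ⊕ negS (x ⊛ t)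
    expand = solve 3 (λ x X t → (con (+ 1) :+ :- x) :* (X :+ t) := ((X :+ t) :+ :- (x :* X)) :+ :- (x :* t)) ≈-refl
    cancel : ∀ a b → a ⊕ negS (a ⊕ negS b) ≈ b
    cancel = solve 2 (λ a b → a :+ :- (a :+ :- b) := b) ≈-refl
    negligible : q^ c ⊛ t ≈ zeroS
    negligible = ≈-trans (≈-sym (*-assoc (q^ c) (q^ (M * c)) (inv (evenPoch M))))
                         (q^∣⇒≈0 N<e (q^∣-⊛ʳ (inv (evenPoch M)) (λ n n<e → trans (q^-+ c (M * c) n) (q^∣q^ _ n n<e))))

  eulerSum-iterate : ∀ c M j → 1 ≤ c → N ≤ M → poch (+ 1) c 2 j ⊛ eulerSum c (suc M) ≈ eulerSum (c + 2 * j) (suc M)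
  eulerSum-iterate c M zero    1≤c N≤M =
    ≈-trans (≋⇒≈ (⊛-identityˡ _)) (≈-reflexive (cong (λ d → eulerSum d (suc M)) (sym (NP.+-identityʳ c))))
  eulerSum-iterate c M (suc j) 1≤c N≤M = begin
    (poch (+ 1) c 2 j ⊛ factor) ⊛ eulerSum c (suc M)
      ≈⟨ swap (poch (+ 1) c 2 j) factor (eulerSum c (suc M)) ⟩
    factor ⊛ (poch (+ 1) c 2 j ⊛ eulerSum c (suc M))
      ≈⟨ *-cong (pochFactor≈1-q^ c 2 j) (eulerSum-iterate c M j 1≤c N≤M) ⟩
    (oneS ⊕ negS (q^ c′)) ⊛ eulerSum c′ (suc M)
      ≈⟨ eulerSum-step c′ M N<e ⟩
    eulerSum (c′ + 2) (suc M)
      ≈⟨ ≈-reflexive (cong (λ d → eulerSum d (suc M)) exponent) ⟩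
    eulerSum (c + 2 * suc j) (suc M) ∎
    where
    factor : FPS
    factor = pochFactor (+ 1) c 2 j
    c′ : ℕ
    c′ = c + 2 * j
    swap : ∀ a b c → (a ⊛ b) ⊛ c ≈ b ⊛ (a ⊛ c)
    swap = solve 3 (λ a b c → (a :* b) :* c := b :* (a :* c)) ≈-refl
    N<e : N < suc M * c′
    N<e = NP.≤-trans (s≤s N≤M) (NP.m≤m*n (suc M) c′ {{N.>-nonZero (NP.≤-trans 1≤c (NP.m≤m+n c (2 * j)))}})
    exponent : c′ + 2 ≡ c + 2 * suc j
    exponent = trans (NP.+-assoc c (2 * j) 2) (cong (_+_ c) (trans (NP.+-comm (2 * j) 2) (sym (NP.*-suc 2 j))))

  eulerSum≈1 : ∀ c M → N < c → eulerSum c (suc M) ≈ oneS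
  eulerSum≈1 c zero    N<c = ≈-trans (+-identityˡ (eulerTerm c 0)) (≈-trans (≋⇒≈ (⊛-identityˡ (inv oneS))) inv-oneS)
  eulerSum≈1 c (suc M) N<c =
    ≈-trans (+-cong (eulerSum≈1 c M N<c)
                    (q^∣⇒≈0 (NP.<-≤-trans N<c (NP.m≤m+n c (M * c))) (q^∣-⊛ʳ (inv (evenPoch (suc M))) (q^∣q^ _))))
            (+-identityʳ oneS)

  -- Euler: Σ_m x^((k+1)m) / (x;x)_m = 1 / (x^(k+1);x)_∞ with x = q².
  euler : ∀ k M → N ≤ M → evenPoch∞ ⊛ eulerSum (2 + 2 * k) (suc M) ≈ evenPoch k
  euler k M N≤M = begin
    evenPoch∞ ⊛ eulerSum c (suc M)
      ≈⟨ ⊛-congʳ (eulerSum c (suc M)) (pochInf≈poch (+ 1) 1 1 N (k + suc N) (NP.m≤n+m (suc N) k)) ⟩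
    evenPoch (k + suc N) ⊛ eulerSum c (suc M)
      ≈⟨ ⊛-congʳ (eulerSum c (suc M)) (evenPoch-+ k (suc N)) ⟩
    (evenPoch k ⊛ tail) ⊛ eulerSum c (suc M)
      ≈⟨ *-assoc (evenPoch k) tail (eulerSum c (suc M)) ⟩
    evenPoch k ⊛ (tail ⊛ eulerSum c (suc M))
      ≈⟨ ⊛-congˡ (evenPoch k) (eulerSum-iterate c M (suc N) (s≤s z≤n) N≤M) ⟩
    evenPoch k ⊛ eulerSum (c + 2 * suc N) (suc M)
      ≈⟨ ⊛-congˡ (evenPoch k) (eulerSum≈1 _ M (NP.≤-trans (NP.m≤m+n (suc N) (suc N + 0)) (NP.m≤n+m _ c))) ⟩
    evenPoch k ⊛ oneS  ≈⟨ ≋⇒≈ (⊛-identityʳ (evenPoch k)) ⟩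
    evenPoch k         ∎
    where
    c : ℕ
    c = 2 + 2 * k
    tail : FPS
    tail = poch (+ 1) c 2 (suc N)

  dil2-inv-poch : ∀ m → dil2 (inv (poch (+ 1) 1 1 m)) ≈ inv (evenPoch m)
  dil2-inv-poch m = ≈-trans (dil2-inv _ (poch-coeff₀ (+ 1) 0 1 m))
                            (inv-cong _ _ (poch-coeff₀ (+ 1) 0 1 m) (evenPoch-coeff₀ m) (≋⇒≈ (dil2-poch m)))

  dil2-gauss : ∀ n k → k ≤ n → dil2 (gauss n k) ≈ (evenPoch n ⊛ inv (evenPoch k)) ⊛ inv (evenPoch (n ∸ k))
  dil2-gauss n k k≤n with k N.≤? n
  ... | no k≰n = ⊥-elim (k≰n k≤n)
  ... | yes _  = begin
    dil2 ((p n ⊛ inv (p k)) ⊛ inv (p (n ∸ k)))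
      ≈⟨ ≈-sym (≋⇒≈ (dil2-⊛ (p n ⊛ inv (p k)) (inv (p (n ∸ k))))) ⟩
    dil2 (p n ⊛ inv (p k)) ⊛ dil2 (inv (p (n ∸ k)))
      ≈⟨ ⊛-congʳ (dil2 (inv (p (n ∸ k)))) (≈-sym (≋⇒≈ (dil2-⊛ (p n) (inv (p k))))) ⟩
    (dil2 (p n) ⊛ dil2 (inv (p k))) ⊛ dil2 (inv (p (n ∸ k)))
      ≈⟨ *-cong (*-cong (≋⇒≈ (dil2-poch n)) (dil2-inv-poch k)) (dil2-inv-poch (n ∸ k)) ⟩
    (evenPoch n ⊛ inv (evenPoch k)) ⊛ inv (evenPoch (n ∸ k)) ∎
    where
    p : ℕ → FPS
    p = poch (+ 1) 1 1

  term-vanishes : ∀ k j → j < k → term (suc k) (suc j) ≈ zeroS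
  term-vanishes k j j<k = ≈-trans
    (⊛-congˡ (q^ e ⊛ inv (evenPoch (suc j)))
             (≋⇒≈ (λ n → trans (cong (λ g → dil2 g n) (gauss-vanishes j k j<k)) (dil2-zeroS n))))
    (zeroʳ (q^ e ⊛ inv (evenPoch (suc j))))
    where
    e : ℕ
    e = suc k * k + 2 * suc (suc k) * suc j

  term-normal : ∀ k m → term (suc k) (suc k + m)
    ≈ (q^ (suc k * k + 2 * suc (suc k) * (suc k + m)) ⊛ inv (evenPoch (suc k + m)))
      ⊛ ((evenPoch (k + m) ⊛ inv (evenPoch k)) ⊛ inv (evenPoch m))
  term-normal k m = ⊛-congˡ (q^ (suc k * k + 2 * suc (suc k) * (suc k + m)) ⊛ inv (evenPoch (suc k + m)))
    (≈-trans (dil2-gauss (k + m) k (NP.m≤m+n k m))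
             (⊛-congˡ (evenPoch (k + m) ⊛ inv (evenPoch k)) (≈-reflexive (cong (inv ∘ evenPoch) (NP.m+n∸m≡n k m)))))

  q^∣term : ∀ k j → q^ j ∣ term k (suc j)
  q^∣term k j = q^∣-weaken j≤e (q^∣-⊛ʳ (dil2 (gauss j (k ∸ 1))) (q^∣-⊛ʳ (inv (evenPoch (suc j))) (q^∣q^ e)))
    where
    e : ℕ
    e = k * (k ∸ 1) + 2 * suc k * suc j
    j≤e : j ≤ e
    j≤e = NP.≤-trans (NP.n≤1+n j) (NP.≤-trans (NP.m≤n*m (suc j) (2 * suc k)) (NP.m≤n+m _ (k * (k ∸ 1))))

  infSum1≈finSum : ∀ t M → N ≤ M → (∀ j → q^ j ∣ t (suc j)) → infSum1 t ≈ finSum (suc M) (t ∘ suc)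
  infSum1≈finSum t M N≤M j∣t = agree (λ n n≤N → infSum1-coeff t M n (NP.≤-trans n≤N N≤M) j∣t)

  infSum1-term≈finSum : ∀ k M → N ≤ M → infSum1 (term (suc k)) ≈ finSum (suc M) (λ m → term (suc k) (suc k + m))
  infSum1-term≈finSum k M N≤M = begin
    infSum1 (term (suc k))
      ≈⟨ infSum1≈finSum (term (suc k)) (k + M) (NP.≤-trans N≤M (NP.m≤n+m M k)) (q^∣term (suc k)) ⟩
    finSum (suc (k + M)) (term (suc k) ∘ suc)
      ≈⟨ ≈-reflexive (cong (λ b → finSum b (term (suc k) ∘ suc)) (sym (NP.+-suc k M))) ⟩
    finSum (k + suc M) (term (suc k) ∘ suc)
      ≈⟨ finSum-drop k (suc M) (term (suc k) ∘ suc) (term-vanishes k) ⟩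
    finSum (suc M) (λ m → term (suc k) (suc k + m)) ∎

  finSum-interleave : ∀ M a b U V → a 0 ≈ U 0 → (∀ m → a (suc m) ⊕ b m ≈ U (suc m) ⊕ negS (V m))
                     → finSum (suc M) a ⊕ finSum M b ≈ finSum (suc M) U ⊕ negS (finSum M V)
  finSum-interleave zero    a b U V a₀≈U₀ _    = +-cong (⊕-congˡ zeroS a₀≈U₀) ≈-refl
  finSum-interleave (suc M) a b U V a₀≈U₀ pair = begin
    (finSum (suc M) a ⊕ a (suc M)) ⊕ (finSum M b ⊕ b M)
      ≈⟨ interchange (finSum (suc M) a) (a (suc M)) (finSum M b) (b M) ⟩
    (finSum (suc M) a ⊕ finSum M b) ⊕ (a (suc M) ⊕ b M)
      ≈⟨ +-cong (finSum-interleave M a b U V a₀≈U₀ pair) (pair M) ⟩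
    (finSum (suc M) U ⊕ negS (finSum M V)) ⊕ (U (suc M) ⊕ negS (V M))
      ≈⟨ interchange-neg (finSum (suc M) U) (finSum M V) (U (suc M)) (V M) ⟩
    (finSum (suc M) U ⊕ U (suc M)) ⊕ negS (finSum M V ⊕ V M) ∎
    where
    interchange : ∀ a b c d → (a ⊕ b) ⊕ (c ⊕ d) ≈ (a ⊕ c) ⊕ (b ⊕ d)
    interchange = solve 4 (λ a b c d → (a :+ b) :+ (c :+ d) := (a :+ c) :+ (b :+ d)) ≈-refl
    interchange-neg : ∀ a b c d → (a ⊕ negS b) ⊕ (c ⊕ negS d) ≈ (a ⊕ c) ⊕ negS (b ⊕ d)
    interchange-neg = solve 4 (λ a b c d → (a :+ :- b) :+ (c :+ :- d) := (a :+ c) :+ :- (b :+ d)) ≈-refl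

  -- The two sides differ by a multiple of W (1 - S y) - 1.
  pair-identity : ∀ Z W y S → W ⊛ (oneS ⊕ negS (S ⊛ y)) ≈ oneS
                  → Z ⊛ (W ⊛ (oneS ⊕ negS y)) ⊕ Z ⊛ (W ⊛ (((S ⊛ y) ⊛ y) ⊛ (oneS ⊕ negS S)))
                    ≈ Z ⊕ negS (Z ⊛ (y ⊛ (oneS ⊕ negS S)))
  pair-identity Z W y S W-relation = begin
    Z ⊛ (W ⊛ (oneS ⊕ negS y)) ⊕ Z ⊛ (W ⊛ (((S ⊛ y) ⊛ y) ⊛ (oneS ⊕ negS S)))
      ≈⟨ expand Z W y S ⟩
    target ⊕ multiplier ⊛ (W ⊛ (oneS ⊕ negS (S ⊛ y)) ⊕ negS oneS)
      ≈⟨ ⊕-congˡ target (⊛-congˡ multiplier (⊕-congʳ (negS oneS) W-relation)) ⟩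
    target ⊕ multiplier ⊛ (oneS ⊕ negS oneS)
      ≈⟨ drop target multiplier ⟩
    target ∎
    where
    target multiplier : FPS
    target     = Z ⊕ negS (Z ⊛ (y ⊛ (oneS ⊕ negS S)))
    multiplier = Z ⊛ ((oneS ⊕ negS y) ⊕ S ⊛ y)
    expand : ∀ Z W y S → Z ⊛ (W ⊛ (oneS ⊕ negS y)) ⊕ Z ⊛ (W ⊛ (((S ⊛ y) ⊛ y) ⊛ (oneS ⊕ negS S)))
             ≈ (Z ⊕ negS (Z ⊛ (y ⊛ (oneS ⊕ negS S))))
               ⊕ (Z ⊛ ((oneS ⊕ negS y) ⊕ S ⊛ y)) ⊛ (W ⊛ (oneS ⊕ negS (S ⊛ y)) ⊕ negS oneS)
    expand = solve 4 (λ Z W y S →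
      Z :* (W :* (con (+ 1) :+ :- y)) :+ Z :* (W :* (((S :* y) :* y) :* (con (+ 1) :+ :- S)))
      := (Z :+ :- (Z :* (y :* (con (+ 1) :+ :- S))))
         :+ (Z :* ((con (+ 1) :+ :- y) :+ S :* y)) :* (W :* (con (+ 1) :+ :- (S :* y)) :+ :- con (+ 1))) ≈-refl
    drop : ∀ a b → a ⊕ b ⊛ (oneS ⊕ negS oneS) ≈ a
    drop = solve 2 (λ a b → a :+ b :* (con (+ 1) :+ :- con (+ 1)) := a) ≈-refl

  -- The paper's k is suc k here; e₁ = 2G_(2k) and e₂ = 2G_(2k+1).
  module Consecutive (k : ℕ) where

    c e₁ e₂ : ℕ
    c  = 2 + 2 * suc k
    e₁ = suc k * suc (3 * suc k)
    e₂ = suc (suc k) * (2 + 3 * suc k)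

    U V : ℕ → FPS
    U m = q^ e₁ ⊛ (inv (evenPoch (suc k)) ⊛ eulerTerm c m)
    V m = q^ e₂ ⊛ (inv (evenPoch (suc k)) ⊛ eulerTerm c m)

    term-head : term (suc k) (suc k + 0) ≈ U 0
    term-head = begin
      term (suc k) (suc k + 0)
        ≈⟨ term-normal k 0 ⟩
      (q^ _ ⊛ inv (evenPoch (suc k + 0))) ⊛ ((evenPoch (k + 0) ⊛ inv (evenPoch k)) ⊛ inv oneS)
        ≈⟨ *-cong (*-cong (q^-cong (exponent-head k)) (≈-reflexive (cong (inv ∘ evenPoch ∘ suc) (NP.+-identityʳ k))))
                  (⊛-congʳ (inv oneS) (≈-trans (≈-reflexive (cong (λ j → evenPoch j ⊛ inv (evenPoch k)) (NP.+-identityʳ k)))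
                                               (evenPoch-⊛-inv k))) ⟩
      (q^ e₁ ⊛ inv (evenPoch (suc k))) ⊛ (oneS ⊛ inv oneS)
        ≈⟨ *-assoc (q^ e₁) (inv (evenPoch (suc k))) (oneS ⊛ inv oneS) ⟩
      U 0 ∎

    module Summands (m : ℕ) where
      a : ℕ
      a = suc k * k + 2 * suc (suc k) * (suc k + suc m)
      Qa y S ik im PW iW Z W : FPS
      Qa  = q^ a
      y  = q^ (2 + 2 * k)
      S  = q^ (2 + 2 * m)
      ik = inv (evenPoch (suc k))
      im = inv (evenPoch (suc m))
      PW = evenPoch (suc k + m)
      iW = inv (evenPoch (suc (suc k + m)))
      Z  = (Qa ⊛ ik) ⊛ im
      W  = PW ⊛ iW

      a-form : term (suc k) (suc k + suc m) ≈ Z ⊛ (W ⊛ (oneS ⊕ negS y))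
      a-form = begin
        term (suc k) (suc k + suc m)
          ≈⟨ term-normal k (suc m) ⟩
        (Qa ⊛ inv (evenPoch (suc k + suc m))) ⊛ ((evenPoch (k + suc m) ⊛ inv (evenPoch k)) ⊛ im)
          ≈⟨ *-cong (⊛-congˡ Qa (≈-reflexive (cong (inv ∘ evenPoch ∘ suc) (NP.+-suc k m))))
                    (⊛-congʳ im (*-cong (≈-reflexive (cong evenPoch (NP.+-suc k m))) (≈-sym (inv-evenPoch-suc k)))) ⟩
        (Qa ⊛ iW) ⊛ ((PW ⊛ ((oneS ⊕ negS y) ⊛ ik)) ⊛ im)
          ≈⟨ regroup Qa iW PW (oneS ⊕ negS y) ik im ⟩
        Z ⊛ (W ⊛ (oneS ⊕ negS y)) ∎
        where
        regroup : ∀ Qa iW PW f ik im → (Qa ⊛ iW) ⊛ ((PW ⊛ (f ⊛ ik)) ⊛ im) ≈ ((Qa ⊛ ik) ⊛ im) ⊛ ((PW ⊛ iW) ⊛ f)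
        regroup = solve 6 (λ Qa iW PW f ik im → (Qa :* iW) :* ((PW :* (f :* ik)) :* im)
                                               := ((Qa :* ik) :* im) :* ((PW :* iW) :* f)) ≈-refl

      b-form : term (suc (suc k)) (suc (suc k) + m) ≈ Z ⊛ (W ⊛ (((S ⊛ y) ⊛ y) ⊛ (oneS ⊕ negS S)))
      b-form = begin
        term (suc (suc k)) (suc (suc k) + m)
          ≈⟨ term-normal (suc k) m ⟩
        (q^ _ ⊛ iW) ⊛ ((PW ⊛ ik) ⊛ inv (evenPoch m))
          ≈⟨ *-cong (⊛-congʳ iW (≈-trans (q^-cong (exponent-b k m))
                                         (≈-trans (q^-+≈ _ _) (⊛-congʳ y (≈-trans (q^-+≈ _ _) (⊛-congʳ y (q^-+≈ a _)))))))
                    (⊛-congˡ (PW ⊛ ik) (≈-sym (inv-evenPoch-suc m))) ⟩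
        (((Qa ⊛ S) ⊛ y) ⊛ y ⊛ iW) ⊛ ((PW ⊛ ik) ⊛ ((oneS ⊕ negS S) ⊛ im))
          ≈⟨ regroup Qa S y iW PW ik im (oneS ⊕ negS S) ⟩
        Z ⊛ (W ⊛ (((S ⊛ y) ⊛ y) ⊛ (oneS ⊕ negS S))) ∎
        where
        regroup : ∀ Qa S y iW PW ik im f → (((Qa ⊛ S) ⊛ y) ⊛ y ⊛ iW) ⊛ ((PW ⊛ ik) ⊛ (f ⊛ im))
                                          ≈ ((Qa ⊛ ik) ⊛ im) ⊛ ((PW ⊛ iW) ⊛ (((S ⊛ y) ⊛ y) ⊛ f))
        regroup = solve 8 (λ Qa S y iW PW ik im f → (((Qa :* S) :* y) :* y :* iW) :* ((PW :* ik) :* (f :* im))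
                                                  := ((Qa :* ik) :* im) :* ((PW :* iW) :* (((S :* y) :* y) :* f))) ≈-refl

      U-form : U (suc m) ≈ Z
      U-form = begin
        q^ e₁ ⊛ (ik ⊛ (q^ (suc m * c) ⊛ im))
          ≈⟨ regroup (q^ e₁) ik (q^ (suc m * c)) im ⟩
        ((q^ e₁ ⊛ q^ (suc m * c)) ⊛ ik) ⊛ im
          ≈⟨ ⊛-congʳ im (⊛-congʳ ik (≈-trans (≋⇒≈ (q^-+ e₁ _)) (q^-cong (exponent-U k m)))) ⟩
        Z ∎
        where
        regroup : ∀ Q ik X im → Q ⊛ (ik ⊛ (X ⊛ im)) ≈ ((Q ⊛ X) ⊛ ik) ⊛ im
        regroup = solve 4 (λ Q ik X im → Q :* (ik :* (X :* im)) := ((Q :* X) :* ik) :* im) ≈-refl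

      V-form : V m ≈ Z ⊛ (y ⊛ (oneS ⊕ negS S))
      V-form = begin
        q^ e₂ ⊛ (ik ⊛ (q^ (m * c) ⊛ inv (evenPoch m)))
          ≈⟨ ⊛-congˡ (q^ e₂) (⊛-congˡ ik (⊛-congˡ (q^ (m * c)) (≈-sym (inv-evenPoch-suc m)))) ⟩
        q^ e₂ ⊛ (ik ⊛ (q^ (m * c) ⊛ ((oneS ⊕ negS S) ⊛ im)))
          ≈⟨ regroup (q^ e₂) ik (q^ (m * c)) (oneS ⊕ negS S) im ⟩
        ((q^ e₂ ⊛ q^ (m * c)) ⊛ ik) ⊛ im ⊛ (oneS ⊕ negS S)
          ≈⟨ ⊛-congʳ (oneS ⊕ negS S) (⊛-congʳ im (⊛-congʳ ik
               (≈-trans (≋⇒≈ (q^-+ e₂ _)) (≈-trans (q^-cong (exponent-V k m)) (q^-+≈ a _))))) ⟩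
        ((Qa ⊛ y) ⊛ ik) ⊛ im ⊛ (oneS ⊕ negS S)
          ≈⟨ regroup′ Qa y ik im (oneS ⊕ negS S) ⟩
        Z ⊛ (y ⊛ (oneS ⊕ negS S)) ∎
        where
        regroup : ∀ Q ik X f im → Q ⊛ (ik ⊛ (X ⊛ (f ⊛ im))) ≈ ((Q ⊛ X) ⊛ ik) ⊛ im ⊛ f
        regroup = solve 5 (λ Q ik X f im → Q :* (ik :* (X :* (f :* im))) := ((Q :* X) :* ik) :* im :* f) ≈-refl
        regroup′ : ∀ Qa y ik im f → ((Qa ⊛ y) ⊛ ik) ⊛ im ⊛ f ≈ ((Qa ⊛ ik) ⊛ im) ⊛ (y ⊛ f)
        regroup′ = solve 5 (λ Qa y ik im f → ((Qa :* y) :* ik) :* im :* f := ((Qa :* ik) :* im) :* (y :* f)) ≈-refl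

      W-relation : W ⊛ (oneS ⊕ negS (S ⊛ y)) ≈ oneS
      W-relation = begin
        (PW ⊛ iW) ⊛ (oneS ⊕ negS (S ⊛ y))
          ≈⟨ ⊛-congˡ W (⊕-congˡ oneS (-‿cong (≈-trans (≋⇒≈ (q^-+ _ _)) (q^-cong (sym (exponent-W k m)))))) ⟩
        (PW ⊛ iW) ⊛ (oneS ⊕ negS (q^ (2 + 2 * (suc k + m))))
          ≈⟨ swap PW iW (oneS ⊕ negS (q^ (2 + 2 * (suc k + m)))) ⟩
        (PW ⊛ (oneS ⊕ negS (q^ (2 + 2 * (suc k + m))))) ⊛ iW
          ≈⟨ ⊛-congʳ iW (⊛-congˡ PW (≈-sym (pochFactor≈1-q^ 2 2 (suc k + m)))) ⟩
        evenPoch (suc (suc k + m)) ⊛ iW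
          ≈⟨ evenPoch-⊛-inv (suc (suc k + m)) ⟩
        oneS ∎
        where
        swap : ∀ a b c → (a ⊛ b) ⊛ c ≈ (a ⊛ c) ⊛ b
        swap = solve 3 (λ a b c → (a :* b) :* c := (a :* c) :* b) ≈-refl

    term-pair : ∀ m → term (suc k) (suc k + suc m) ⊕ term (suc (suc k)) (suc (suc k) + m) ≈ U (suc m) ⊕ negS (V m)
    term-pair m = begin
      term (suc k) (suc k + suc m) ⊕ term (suc (suc k)) (suc (suc k) + m)
        ≈⟨ +-cong a-form b-form ⟩
      Z ⊛ (W ⊛ (oneS ⊕ negS y)) ⊕ Z ⊛ (W ⊛ (((S ⊛ y) ⊛ y) ⊛ (oneS ⊕ negS S)))
        ≈⟨ pair-identity Z W y S W-relation ⟩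
      Z ⊕ negS (Z ⊛ (y ⊛ (oneS ⊕ negS S)))
        ≈⟨ +-cong (≈-sym U-form) (-‿cong (≈-sym V-form)) ⟩
      U (suc m) ⊕ negS (V m) ∎
      where open Summands m

    consecutive-sums : evenPoch∞ ⊛ (infSum1 (term (suc k)) ⊕ infSum1 (term (suc (suc k)))) ≈ q^ e₁ ⊕ negS (q^ e₂)
    consecutive-sums = begin
      evenPoch∞ ⊛ (infSum1 (term (suc k)) ⊕ infSum1 (term (suc (suc k))))
        ≈⟨ ⊛-congˡ evenPoch∞ (+-cong (infSum1-term≈finSum k (suc N) (NP.n≤1+n N)) (infSum1-term≈finSum (suc k) N NP.≤-refl)) ⟩
      evenPoch∞ ⊛ (finSum (suc (suc N)) a ⊕ finSum (suc N) b)
        ≈⟨ ⊛-congˡ evenPoch∞ (finSum-interleave (suc N) a b U V term-head term-pair) ⟩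
      evenPoch∞ ⊛ (finSum (suc (suc N)) U ⊕ negS (finSum (suc N) V))
        ≈⟨ ⊛-congˡ evenPoch∞ (+-cong (finSum-factor e₁ (suc (suc N))) (-‿cong (finSum-factor e₂ (suc N)))) ⟩
      evenPoch∞ ⊛ (q^ e₁ ⊛ (ik ⊛ eulerSum c (suc (suc N))) ⊕ negS (q^ e₂ ⊛ (ik ⊛ eulerSum c (suc N))))
        ≈⟨ distribute evenPoch∞ ik (q^ e₁) (q^ e₂) (eulerSum c (suc (suc N))) (eulerSum c (suc N)) ⟩
      q^ e₁ ⊛ (ik ⊛ (evenPoch∞ ⊛ eulerSum c (suc (suc N)))) ⊕ negS (q^ e₂ ⊛ (ik ⊛ (evenPoch∞ ⊛ eulerSum c (suc N))))
        ≈⟨ +-cong (⊛-congˡ (q^ e₁) (⊛-congˡ ik (euler (suc k) (suc N) (NP.n≤1+n N))))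
                  (-‿cong (⊛-congˡ (q^ e₂) (⊛-congˡ ik (euler (suc k) N NP.≤-refl)))) ⟩
      q^ e₁ ⊛ (ik ⊛ evenPoch (suc k)) ⊕ negS (q^ e₂ ⊛ (ik ⊛ evenPoch (suc k)))
        ≈⟨ +-cong (⊛-congˡ (q^ e₁) ik⊛P≈1) (-‿cong (⊛-congˡ (q^ e₂) ik⊛P≈1)) ⟩
      q^ e₁ ⊛ oneS ⊕ negS (q^ e₂ ⊛ oneS)
        ≈⟨ +-cong (≋⇒≈ (⊛-identityʳ (q^ e₁))) (-‿cong (≋⇒≈ (⊛-identityʳ (q^ e₂)))) ⟩
      q^ e₁ ⊕ negS (q^ e₂) ∎
      where
      a b : ℕ → FPS
      a m = term (suc k) (suc k + m)
      b m = term (suc (suc k)) (suc (suc k) + m)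
      ik : FPS
      ik = inv (evenPoch (suc k))
      finSum-factor : ∀ e M → finSum M (λ m → q^ e ⊛ (ik ⊛ eulerTerm c m)) ≈ q^ e ⊛ (ik ⊛ eulerSum c M)
      finSum-factor e M = ≈-sym (≈-trans (⊛-congˡ (q^ e) (⊛-finSum M ik (eulerTerm c)))
                                         (⊛-finSum M (q^ e) (λ m → ik ⊛ eulerTerm c m)))
      ik⊛P≈1 : ik ⊛ evenPoch (suc k) ≈ oneS
      ik⊛P≈1 = ≈-trans (*-comm ik (evenPoch (suc k))) (evenPoch-⊛-inv (suc k))
      distribute : ∀ E i Q Q′ F F′ → E ⊛ (Q ⊛ (i ⊛ F) ⊕ negS (Q′ ⊛ (i ⊛ F′)))
                                     ≈ Q ⊛ (i ⊛ (E ⊛ F)) ⊕ negS (Q′ ⊛ (i ⊛ (E ⊛ F′)))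
      distribute = solve 6 (λ E i Q Q′ F F′ → E :* (Q :* (i :* F) :+ :- (Q′ :* (i :* F′)))
                                            := Q :* (i :* (E :* F)) :+ :- (Q′ :* (i :* (E :* F′)))) ≈-refl

  mono≈cst-⊛-q^ : ∀ s e → mono s e ≈ cst s ⊛ q^ e
  mono≈cst-⊛-q^ s e = ≋⇒≈ (λ n → sym (trans (scale-as-⊛ s (q^ e) n)
    (trans (scale-mono s (+ 1) e n) (cong (λ c → mono c e n) (ZP.*-identityʳ s)))))

  pentagonal-step : ∀ k → let open Consecutive k in
    pentagonalSum (suc (suc k)) ≈ pentagonalSum (suc k) ⊕ negS (cst (negOnePow k)) ⊛ (q^ e₁ ⊕ negS (q^ e₂))
  pentagonal-step k = begin
    pentagonalSum (suc (suc k))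
      ≈⟨ ≋⇒≈ (pentagonalSum-suc k) ⟩
    pentagonalSum (suc k) ⊕ pentagonalTerm (2 * suc k) ⊕ pentagonalTerm (suc (2 * suc k))
      ≈⟨ +-cong (⊕-congˡ (pentagonalSum (suc k)) even-term) odd-term ⟩
    pentagonalSum (suc k) ⊕ σ ⊛ q^ e₁ ⊕ negS (σ ⊛ q^ e₂)
      ≈⟨ factor-out (pentagonalSum (suc k)) σ (q^ e₁) (q^ e₂) ⟩
    pentagonalSum (suc k) ⊕ σ ⊛ (q^ e₁ ⊕ negS (q^ e₂))
      ≈⟨ ⊕-congˡ (pentagonalSum (suc k)) (⊛-congʳ (q^ e₁ ⊕ negS (q^ e₂)) (≋⇒≈ (mono-neg (negOnePow k) 0))) ⟩
    pentagonalSum (suc k) ⊕ negS (cst (negOnePow k)) ⊛ (q^ e₁ ⊕ negS (q^ e₂)) ∎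
    where
    open Consecutive k
    σ : FPS
    σ = cst (negOnePow (suc k))
    even-term : pentagonalTerm (2 * suc k) ≈ σ ⊛ q^ e₁
    even-term = ≈-trans (≈-reflexive (cong₂ mono (negOnePow-T-even (suc k)) (twice-G-even (suc k))))
                        (mono≈cst-⊛-q^ _ e₁)
    odd-term : pentagonalTerm (suc (2 * suc k)) ≈ negS (σ ⊛ q^ e₂)
    odd-term = ≈-trans (≈-reflexive (cong₂ mono (negOnePow-T-odd (suc k)) (twice-G-odd (suc k))))
                       (≈-trans (≋⇒≈ (mono-neg (negOnePow (suc k)) e₂)) (-‿cong (mono≈cst-⊛-q^ _ e₂)))
    factor-out : ∀ L s x y → L ⊕ s ⊛ x ⊕ negS (s ⊛ y) ≈ L ⊕ s ⊛ (x ⊕ negS y)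
    factor-out = solve 4 (λ L s x y → L :+ s :* x :+ :- (s :* y) := L :+ s :* (x :+ :- y)) ≈-refl

  rhs≈ : ∀ k → rhs (suc k) ≈ A ⊕ cst (negOnePow k) ⊛ (A ⊛ infSum1 (term (suc k)))
  rhs≈ k = ⊕-congˡ A (≈-sym (≋⇒≈ (scale-as-⊛ (negOnePow k) (A ⊛ infSum1 (term (suc k))))))

  base-case : evenPoch∞ ⊛ (oneS ⊕ infSum1 (term 1)) ≈ oneS ⊕ negS (q^ 2)
  base-case = begin
    evenPoch∞ ⊛ (oneS ⊕ infSum1 (term 1))
      ≈⟨ ⊛-congˡ evenPoch∞ (⊕-congˡ oneS (≈-trans (infSum1-term≈finSum 0 N NP.≤-refl)
                                                 (finSum-cong (suc N) (λ m _ → term-1≈eulerTerm m)))) ⟩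
    evenPoch∞ ⊛ (oneS ⊕ finSum (suc N) (eulerTerm 4 ∘ suc))
      ≈⟨ ⊛-congˡ evenPoch∞ (≈-sym (≈-trans (finSum-+ 1 (suc N) (eulerTerm 4))
                                           (⊕-congʳ (finSum (suc N) (eulerTerm 4 ∘ suc)) eulerSum₁≈1))) ⟩
    evenPoch∞ ⊛ eulerSum 4 (suc (suc N))
      ≈⟨ euler 1 (suc N) (NP.n≤1+n N) ⟩
    oneS ⊛ pochFactor (+ 1) 2 2 0
      ≈⟨ ≈-trans (≋⇒≈ (⊛-identityˡ _)) (pochFactor≈1-q^ 2 2 0) ⟩
    oneS ⊕ negS (q^ 2) ∎
    where
    eulerSum₁≈1 : eulerSum 4 1 ≈ oneS
    eulerSum₁≈1 = ≈-trans (+-identityˡ (eulerTerm 4 0)) (≈-trans (≋⇒≈ (⊛-identityˡ (inv oneS))) inv-oneS)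
    term-1≈eulerTerm : ∀ m → term 1 (1 + m) ≈ eulerTerm 4 (suc m)
    term-1≈eulerTerm m = begin
      term 1 (1 + m)
        ≈⟨ term-normal 0 m ⟩
      (q^ (4 * suc m) ⊛ inv (evenPoch (suc m))) ⊛ ((evenPoch m ⊛ inv oneS) ⊛ inv (evenPoch m))
        ≈⟨ *-cong (⊛-congʳ (inv (evenPoch (suc m))) (q^-cong (NP.*-comm 4 (suc m))))
                  (≈-trans (⊛-congʳ (inv (evenPoch m)) (≈-trans (⊛-congˡ (evenPoch m) inv-oneS) (≋⇒≈ (⊛-identityʳ (evenPoch m)))))
                           (evenPoch-⊛-inv m)) ⟩
      eulerTerm 4 (suc m) ⊛ oneS
        ≈⟨ ≋⇒≈ (⊛-identityʳ (eulerTerm 4 (suc m))) ⟩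
      eulerTerm 4 (suc m) ∎

  induction-step : ∀ E Ev A L S S′ s → A ≈ Ev ⊛ E → E ⊛ L ≈ A ⊕ s ⊛ (A ⊛ S)
                   → E ⊛ (L ⊕ negS s ⊛ (Ev ⊛ (S ⊕ S′))) ≈ A ⊕ negS s ⊛ (A ⊛ S′)
  induction-step E Ev A L S S′ s A≈ E⊛L≈ = begin
    E ⊛ (L ⊕ negS s ⊛ (Ev ⊛ (S ⊕ S′)))           ≈⟨ expand E Ev L S S′ s ⟩
    E ⊛ L ⊕ negS s ⊛ ((Ev ⊛ E) ⊛ (S ⊕ S′))       ≈⟨ +-cong E⊛L≈ (⊛-congˡ (negS s) (⊛-congʳ (S ⊕ S′) (≈-sym A≈))) ⟩
    (A ⊕ s ⊛ (A ⊛ S)) ⊕ negS s ⊛ (A ⊛ (S ⊕ S′))  ≈⟨ cancel A S S′ s ⟩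
    A ⊕ negS s ⊛ (A ⊛ S′)                        ∎
    where
    expand : ∀ E Ev L S S′ s → E ⊛ (L ⊕ negS s ⊛ (Ev ⊛ (S ⊕ S′)))
                               ≈ E ⊛ L ⊕ negS s ⊛ ((Ev ⊛ E) ⊛ (S ⊕ S′))
    expand = solve 6 (λ E Ev L S S′ s → E :* (L :+ :- s :* (Ev :* (S :+ S′)))
                                       := E :* L :+ :- s :* ((Ev :* E) :* (S :+ S′))) ≈-refl
    cancel : ∀ A S S′ s → (A ⊕ s ⊛ (A ⊛ S)) ⊕ negS s ⊛ (A ⊛ (S ⊕ S′)) ≈ A ⊕ negS s ⊛ (A ⊛ S′)
    cancel = solve 4 (λ A S S′ s → (A :+ s :* (A :* S)) :+ :- s :* (A :* (S :+ S′)) := A :+ :- s :* (A :* S′)) ≈-refl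

  lhs≈rhs : ∀ k → lhs (suc k) ≈ rhs (suc k)
  lhs≈rhs zero    = begin
    negPoch∞ ⊛ pentagonalSum 1
      ≈⟨ ⊛-congˡ negPoch∞ (≋⇒≈ (λ n → cong (oneS n +ℤ_) (mono-neg (+ 1) 2 n))) ⟩
    negPoch∞ ⊛ (oneS ⊕ negS (q^ 2))
      ≈⟨ ⊛-congˡ negPoch∞ (≈-sym base-case) ⟩
    negPoch∞ ⊛ (evenPoch∞ ⊛ (oneS ⊕ S₁))
      ≈⟨ expand negPoch∞ evenPoch∞ S₁ ⟩
    Ev⊛E ⊕ cst (+ 1) ⊛ (Ev⊛E ⊛ S₁)
      ≈⟨ ≈-sym (+-cong A≈evenPoch∞-⊛-negPoch∞ (⊛-congˡ (cst (+ 1)) (⊛-congʳ S₁ A≈evenPoch∞-⊛-negPoch∞))) ⟩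
    A ⊕ cst (+ 1) ⊛ (A ⊛ S₁)
      ≈⟨ ≈-sym (rhs≈ 0) ⟩
    rhs 1 ∎
    where
    S₁ Ev⊛E : FPS
    S₁ = infSum1 (term 1)
    Ev⊛E = evenPoch∞ ⊛ negPoch∞
    expand : ∀ E Ev S → E ⊛ (Ev ⊛ (oneS ⊕ S)) ≈ Ev ⊛ E ⊕ cst (+ 1) ⊛ ((Ev ⊛ E) ⊛ S)
    expand = solve 3 (λ E Ev S → E :* (Ev :* (con (+ 1) :+ S)) := Ev :* E :+ con (+ 1) :* ((Ev :* E) :* S)) ≈-refl
  lhs≈rhs (suc k) = begin
    negPoch∞ ⊛ pentagonalSum (suc (suc k))
      ≈⟨ ⊛-congˡ negPoch∞ (pentagonal-step k) ⟩
    negPoch∞ ⊛ (pentagonalSum (suc k) ⊕ negS s ⊛ (q^ e₁ ⊕ negS (q^ e₂)))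
      ≈⟨ ⊛-congˡ negPoch∞ (⊕-congˡ (pentagonalSum (suc k)) (⊛-congˡ (negS s) (≈-sym consecutive-sums))) ⟩
    negPoch∞ ⊛ (pentagonalSum (suc k) ⊕ negS s ⊛ (evenPoch∞ ⊛ (S ⊕ S′)))
      ≈⟨ induction-step negPoch∞ evenPoch∞ A (pentagonalSum (suc k)) S S′ s
                        A≈evenPoch∞-⊛-negPoch∞ (≈-trans (lhs≈rhs k) (rhs≈ k)) ⟩
    A ⊕ negS s ⊛ (A ⊛ S′)
      ≈⟨ ⊕-congˡ A (⊛-congʳ (A ⊛ S′) (≈-sym (≋⇒≈ (mono-neg (negOnePow k) 0)))) ⟩
    A ⊕ cst (negOnePow (suc k)) ⊛ (A ⊛ S′)
      ≈⟨ ≈-sym (rhs≈ (suc k)) ⟩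
    rhs (suc (suc k)) ∎
    where
    open Consecutive k using (e₁; e₂; consecutive-sums)
    s S S′ : FPS
    s  = cst (negOnePow k)
    S  = infSum1 (term (suc k))
    S′ = infSum1 (term (suc (suc k)))

theorem1p1 : (k : ℕ) → 1 ≤ k → (N : ℕ) → lhs k N ≡ rhs k N
theorem1p1 (suc k) _ N = coeff-≡ (Truncated.lhs≈rhs N k) N NP.≤-refl
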